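{- Let $n\ge3$, $p\in[0,1]$, and let $T_1$ and $T_2$ be two rooted phylogenies chosen independently and uniformly at random (with replacement) from $RP(n)$. Then $E(d^{(p)}(T_1,T_2))=\binom{n}{3}\left(\frac{2}{3}\, r'(n)^2+2\,p\, r'(n)\, u'(n)\right)$, where $d^{(p)}$ is the parametric triplet distance.
   Context: Rooted phylogeny over $S$: rooted tree with leaf set $S$, every internal node having at least two children (up to label-preserving isomorphism); resolved node: exactly two children; fully resolved: all internal nodes resolved. $RP(n)$: set of all rooted phylogenies over $[n]$. For a triplet $X$ (3-subset), $T|X$ is the restriction (minimal spanning subtree with degree-two non-root nodes suppressed), and $X$ is resolved in $T$ if $T|X$ is fully resolved. $d^{(p)}(T_1,T_2)=|\mathcal{D}(T_1,T_2)|+p(|\mathcal{R}_1(T_1,T_2)|+|\mathcal{R}_2(T_1,T_2)|)$, where $\mathcal{D}$ is the set of triplets resolved in both trees differently, $\mathcal{R}_1$ those resolved only in $T_1$, $\mathcal{R}_2$ those resolved only in $T_2$. $r'(n)$ is the probability that a given fixed triplet over $[n]$ is resolved in a tree chosen uniformly at random from $RP(n)$, and $u'(n)=1-r'(n)$.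
   Formalization: The parameter p ranges over the rationals in [0,1] rather than over all real numbers in [0,1]. -}

module Defs where

open import Data.Bool using (Bool; true; false; _∧_; _∨_; not; if_then_else_)
open import Data.Nat using (ℕ; zero; suc; _≡ᵇ_; _≤ᵇ_)
import Data.Nat
open import Data.Fin using (Fin)
open import Data.Vec using (Vec; []; _∷_; replicate; toList; zipWith)
open import Data.List using (List; []; _∷_; map; concatMap; filterᵇ; length; foldr; zip)
open import Data.Bool.ListAction using (all; any)
open import Data.Product using (_×_; _,_; proj₁; proj₂)
open import Data.Integer using (+_)
open import Data.Rational using (ℚ; _/_; 0ℚ; 1ℚ; _+_; _-_; _*_)
open import Data.Rational as ℚ using ()
open import Data.Fin.Subset using (Subset; _∩_; ∣_∣)

allVec : (m : ℕ) → List (Vec Bool m)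
allVec zero = [] ∷ []
allVec (suc m) = concatMap (λ v → (true ∷ v) ∷ (false ∷ v) ∷ []) (allVec m)

subsets : (n : ℕ) → List (Subset n)
subsets n = allVec n

eqᵇ : ∀ {m} → Vec Bool m → Vec Bool m → Bool
eqᵇ [] [] = true
eqᵇ (a ∷ u) (b ∷ v) = ((a ∧ b) ∨ (not a ∧ not b)) ∧ eqᵇ u v

⊆ᵇ : ∀ {m} → Vec Bool m → Vec Bool m → Bool
⊆ᵇ [] [] = true
⊆ᵇ (a ∷ u) (b ∷ v) = (not a ∨ b) ∧ ⊆ᵇ u v

⊂ᵇ : ∀ {m} → Vec Bool m → Vec Bool m → Bool
⊂ᵇ u v = ⊆ᵇ u v ∧ not (eqᵇ u v)

emptyᵇ : ∀ {m} → Vec Bool m → Bool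
emptyᵇ v = ∣ v ∣ ≡ᵇ 0

-- Rooted phylogenies over [n], represented canonically by their
-- cluster systems (hierarchies).  A family of clusters is a bit-vector
-- indexed by the enumeration 'subsets n'; each family occurs once.

record Family (n : ℕ) : Set where
  constructor fam
  field bits : Vec Bool (length (subsets n))
open Family public

clusters : ∀ {n} → Family n → List (Subset n)
clusters {n} F =
  map proj₁ (filterᵇ proj₂ (zip (subsets n) (toList (bits F))))

memᵇ : ∀ {n} → Subset n → List (Subset n) → Bool
memᵇ C cs = any (eqᵇ C) cs

singleton : ∀ {n} → Fin n → Subset n
singleton Fin.zero = true ∷ replicate _ false
singleton (Fin.suc i) = false ∷ singleton i

allFinᵇ : (n : ℕ) → (Fin n → Bool) → Bool
allFinᵇ zero f = true
allFinᵇ (suc n) f = f Fin.zero ∧ allFinᵇ n (λ i → f (Fin.suc i))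

compatibleᵇ : ∀ {n} → Subset n → Subset n → Bool
compatibleᵇ A B = ⊆ᵇ A B ∨ ⊆ᵇ B A ∨ emptyᵇ (A ∩ B)

-- These are
-- exactly the cluster systems of rooted phylogenies over [n]
-- (internal nodes with >= 2 children), bijectively up to isomorphism.
isPhylogeny : ∀ {n} → Family n → Bool
isPhylogeny {n} F =
  all (λ C → not (emptyᵇ C)) cs
  ∧ memᵇ (replicate n true) cs
  ∧ allFinᵇ n (λ i → memᵇ (singleton i) cs)
  ∧ all (λ A → all (compatibleᵇ A) cs) cs
  where cs = clusters F

RP : (n : ℕ) → List (Family n)
RP n = filterᵇ isPhylogeny (map fam (allVec (length (subsets n))))

inRestrᵇ : ∀ {n} → Family n → Subset n → Subset n → Bool
inRestrᵇ F X Y = not (emptyᵇ Y) ∧ any (λ C → eqᵇ (C ∩ X) Y) (clusters F)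

restrClusters : ∀ {n} → Family n → Subset n → List (Subset n)
restrClusters {n} F X = filterᵇ (inRestrᵇ F X) (subsets n)

children : ∀ {n} → Family n → Subset n → Subset n → List (Subset n)
children F X Y =
  filterᵇ (λ Z → ⊂ᵇ Z Y ∧ not (any (λ W → ⊂ᵇ Z W ∧ ⊂ᵇ W Y) rs)) rs
  where rs = restrClusters F X

resolvedᵇ : ∀ {n} → Family n → Subset n → Bool
resolvedᵇ F X =
  all (λ Y → if 2 ≤ᵇ ∣ Y ∣ then length (children F X Y) ≡ᵇ 2 else true)
      (restrClusters F X)

sameRestrᵇ : ∀ {n} → Family n → Family n → Subset n → Bool
sameRestrᵇ {n} F G X =
  all (λ Y → eqᵇ (inRestrᵇ F X Y ∷ []) (inRestrᵇ G X Y ∷ [])) (subsets n)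

triplets : (n : ℕ) → List (Subset n)
triplets n = filterᵇ (λ X → ∣ X ∣ ≡ᵇ 3) (subsets n)

Dcount : ∀ {n} → Family n → Family n → ℕ
Dcount {n} F G = length (filterᵇ
  (λ X → resolvedᵇ F X ∧ resolvedᵇ G X ∧ not (sameRestrᵇ F G X)) (triplets n))

R1count : ∀ {n} → Family n → Family n → ℕ
R1count {n} F G = length (filterᵇ
  (λ X → resolvedᵇ F X ∧ not (resolvedᵇ G X)) (triplets n))

R2count : ∀ {n} → Family n → Family n → ℕ
R2count {n} F G = length (filterᵇ
  (λ X → not (resolvedᵇ F X) ∧ resolvedᵇ G X) (triplets n))

ℕtoℚ : ℕ → ℚ
ℕtoℚ k = + k / 1

dp : ∀ {n} → ℚ → Family n → Family n → ℚ
dp p F G = ℕtoℚ (Dcount F G) + p * ℕtoℚ (R1count F G Data.Nat.+ R2count F G)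

-- a / b in ℚ (with the convention a / 0 = 0, never used for b > 0)
frac : ℕ → ℕ → ℚ
frac a zero = 0ℚ
frac a (suc b) = + a / suc b

sumℚ : List ℚ → ℚ
sumℚ = foldr _+_ 0ℚ

expectedDist : ℕ → ℚ → ℚ
expectedDist n p =
  frac 1 (N Data.Nat.* N) * sumℚ (concatMap (λ F → map (λ G → dp p F G) (RP n)) (RP n))
  where N = length (RP n)

firstTriplet : (n : ℕ) → Subset n
firstTriplet zero = []
firstTriplet (suc zero) = true ∷ []
firstTriplet (suc (suc zero)) = true ∷ true ∷ []
firstTriplet (suc (suc (suc n))) = true ∷ true ∷ true ∷ replicate n false

r′ : ℕ → ℚ
r′ n = frac (length (filterᵇ (λ F → resolvedᵇ F (firstTriplet n)) (RP n)))
            (length (RP n))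

u′ : ℕ → ℚ
u′ n = 1ℚ - r′ n

-- The symmetric group on [n] acts on cluster systems; the action preserves RP(n), restrictions and
-- resolution, and is transitive on triplets.  Hence, summed over all pairs (T₁, T₂) ∈ RP(n)², each of
-- |D|, |R₁| and |R₂| equals C(n,3) times the number of pairs for which the fixed triplet X₀ = {0,1,2} is
-- counted.  Restricted to X₀ a phylogeny is either the star or one of the three resolved triplets
-- 01|2, 02|1, 12|0 (its clusters contain the singletons and X₀, and at most one pair, by compatibility);
-- transpositions fixing X₀ permute the three, so each occurs in A = r′(n)|RP(n)|/3 phylogenies.  Thus X₀
-- is resolved differently in 6A² pairs and resolved in exactly one of the two trees in 2|RP(n)|² r′u′ pairs,
-- and dividing by |RP(n)|² gives the formula; it is affine in p.

module Submission where

import Algebra.Properties.CommutativeMonoid.Sum as CommMonoidSum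
open import Algebra.Bundles using (CommutativeMonoid)
open import Data.Bool using (Bool; true; false; _∧_; _∨_; not; if_then_else_; T; T?)
open import Data.Bool.ListAction using (and; or; all; any)
open import Data.Bool.Properties using (∧-commutativeMonoid; ∨-commutativeMonoid; T-≡)
open import Data.Empty using (⊥-elim)
open import Data.Fin using (Fin; zero; suc)
open import Data.Fin.Permutation
  using (Permutation′; _⟨$⟩ʳ_; _⟨$⟩ˡ_; inverseˡ; inverseʳ; flip; _∘ₚ_; lift₀; transpose; id)
open import Data.Fin.Subset using (Subset; _∩_; ∣_∣; ⊥)
open import Data.List using (List; []; _∷_; map; filterᵇ; length; zip; concatMap)
open import Data.List.Membership.Propositional using (_∈_; _∉_)
open import Data.List.Membership.Propositional.Properties using (∈-filter⁺; ∈-filter⁻; ∈-map⁺; ∈-map⁻)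
open import Data.List.Membership.Propositional.Properties.WithK using (unique∧set⇒bag)
open import Data.List.Properties using (map-∘; map-cong; map-cong-local; length-map)
open import Data.List.Relation.Binary.BagAndSetEquality using (∼bag⇒↭)
open import Data.List.Relation.Binary.Permutation.Propositional using (_↭_; ↭⇒↭ₛ; ↭-trans; ↭-reflexive)
open import Data.List.Relation.Binary.Permutation.Propositional.Properties using (map⁺; filter-↭; ↭-length)
open import Data.List.Relation.Binary.Permutation.Setoid.Properties using (foldr-commMonoid)
open import Data.List.Relation.Unary.All as All using ([]; _∷_)
open import Data.List.Relation.Unary.AllPairs using ([]; _∷_)
open import Data.List.Relation.Unary.Any using (here; there)
open import Data.List.Relation.Unary.Unique.Propositional using (Unique)
import Data.List.Relation.Unary.Unique.Propositional.Properties as Unique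
open import Data.Nat using (ℕ; zero; suc; _≡ᵇ_; _≤ᵇ_)
open import Data.Nat.ListAction using (sum)
open import Data.Nat.ListAction.Properties using (sum-↭)
open import Data.Nat.Properties using (+-0-commutativeMonoid; suc-injective)
open import Data.Product using (_×_; _,_; proj₁; proj₂; ∃; ∃₂)
open import Data.Vec as Vec using (Vec; []; _∷_; lookup; tabulate; replicate; tail; toList; fromList)
open import Data.Vec.Properties
  using (lookup∘tabulate; tabulate∘lookup; tabulate-cong; lookup-zipWith; lookup-replicate)
import Data.Vec.Properties as Vecₚ
open import Function using (_∘_; mk⇔; Equivalence)
open import Relation.Binary.PropositionalEquality
open import Relation.Nullary using (¬_)

open import Defs

open CommMonoidSum +-0-commutativeMonoid using (sum-permute; sum-cong-≗) renaming (sum to ∑)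

private variable
  A B : Set
  xs ys : List A
  k l m n : ℕ

true⇔true⇒≡ : {a b : Bool} → (a ≡ true → b ≡ true) → (b ≡ true → a ≡ true) → a ≡ b
true⇔true⇒≡ {true}  {true}  _ _ = refl
true⇔true⇒≡ {true}  {false} f _ = sym (f refl)
true⇔true⇒≡ {false} {true}  _ g = g refl
true⇔true⇒≡ {false} {false} _ _ = refl

unique-sameElements⇒↭ : Unique xs → Unique ys →
  (∀ {z} → z ∈ xs → z ∈ ys) → (∀ {z} → z ∈ ys → z ∈ xs) → xs ↭ ys
unique-sameElements⇒↭ ux uy to from = ∼bag⇒↭ (unique∧set⇒bag ux uy (mk⇔ to from))

module _ (p : A → Bool) where

  all-↭ : xs ↭ ys → all p xs ≡ all p ys
  all-↭ q = foldr-commMonoid ∧.setoid ∧.isCommutativeMonoid (↭⇒↭ₛ (map⁺ p q))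
    where module ∧ = CommutativeMonoid ∧-commutativeMonoid

  any-↭ : xs ↭ ys → any p xs ≡ any p ys
  any-↭ q = foldr-commMonoid ∨.setoid ∨.isCommutativeMonoid (↭⇒↭ₛ (map⁺ p q))
    where module ∨ = CommutativeMonoid ∨-commutativeMonoid

  filterᵇ-↭ : xs ↭ ys → filterᵇ p xs ↭ filterᵇ p ys
  filterᵇ-↭ = filter-↭ (T? ∘ p)

  all-true⁻ : all p xs ≡ true → ∀ {x} → x ∈ xs → p x ≡ true
  all-true⁻ {y ∷ _} e (here refl) with p y | e
  ... | true | _ = refl
  all-true⁻ {y ∷ _} e (there x∈) with p y | e
  ... | true | e′ = all-true⁻ e′ x∈

  all-true⁺ : ∀ xs → (∀ {x} → x ∈ xs → p x ≡ true) → all p xs ≡ true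
  all-true⁺ []       _ = refl
  all-true⁺ (x ∷ xs) h rewrite h (here refl) = all-true⁺ xs (h ∘ there)

  any-true⁻ : ∀ xs → any p xs ≡ true → ∃ λ x → x ∈ xs × p x ≡ true
  any-true⁻ (x ∷ xs) e with p x in px
  ... | true = x , here refl , px
  ... | false with y , y∈ , py ← any-true⁻ xs e = y , there y∈ , py

  any-true⁺ : ∀ {x} → x ∈ xs → p x ≡ true → any p xs ≡ true
  any-true⁺ (here refl) e rewrite e = refl
  any-true⁺ {y ∷ _} (there x∈) e with p y
  ... | true  = refl
  ... | false = any-true⁺ x∈ e

  ∈-filterᵇ⁺ : ∀ {x} → x ∈ xs → p x ≡ true → x ∈ filterᵇ p xs
  ∈-filterᵇ⁺ x∈ e = ∈-filter⁺ (T? ∘ p) x∈ (Equivalence.from T-≡ e)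

  ∈-filterᵇ⁻ : ∀ {x} → x ∈ filterᵇ p xs → x ∈ xs × p x ≡ true
  ∈-filterᵇ⁻ {xs} x∈ with x∈xs , px ← ∈-filter⁻ (T? ∘ p) {xs = xs} x∈ = x∈xs , Equivalence.to T-≡ px

all-map : (p : B → Bool) (f : A → B) → ∀ xs → all p (map f xs) ≡ all (p ∘ f) xs
all-map p f xs = cong and (sym (map-∘ xs))

any-map : (p : B → Bool) (f : A → B) → ∀ xs → any p (map f xs) ≡ any (p ∘ f) xs
any-map p f xs = cong or (sym (map-∘ xs))

all-cong : {p q : A → Bool} → p ≗ q → all p ≗ all q
all-cong h xs = cong and (map-cong h xs)

any-cong : {p q : A → Bool} → p ≗ q → any p ≗ any q
any-cong h xs = cong or (map-cong h xs)

filterᵇ-cong : {p q : A → Bool} → p ≗ q → filterᵇ p ≗ filterᵇ q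
filterᵇ-cong         h []       = refl
filterᵇ-cong {p = p} {q} h (x ∷ xs) with p x | q x | h x
... | true  | _ | refl = cong (x ∷_) (filterᵇ-cong h xs)
... | false | _ | refl = filterᵇ-cong h xs

filterᵇ-map : (p : B → Bool) (f : A → B) → ∀ xs → filterᵇ p (map f xs) ≡ map f (filterᵇ (p ∘ f) xs)
filterᵇ-map p f []       = refl
filterᵇ-map p f (x ∷ xs) with p (f x)
... | true  = cong (f x ∷_) (filterᵇ-map p f xs)
... | false = filterᵇ-map p f xs

module _ {f : A → B} {zs : List B} (zs↭ : zs ↭ map f xs) where

  all-↭-map : {p : B → Bool} {q : A → Bool} → p ∘ f ≗ q → all p zs ≡ all q xs
  all-↭-map {p} h = trans (all-↭ p zs↭) (trans (all-map p f xs) (all-cong h xs))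

  any-↭-map : {p : B → Bool} {q : A → Bool} → p ∘ f ≗ q → any p zs ≡ any q xs
  any-↭-map {p} h = trans (any-↭ p zs↭) (trans (any-map p f xs) (any-cong h xs))

  filterᵇ-↭-map : {p : B → Bool} {q : A → Bool} → p ∘ f ≗ q → filterᵇ p zs ↭ map f (filterᵇ q xs)
  filterᵇ-↭-map {p} h = ↭-trans (filterᵇ-↭ p zs↭)
    (↭-reflexive (trans (filterᵇ-map p f xs) (cong (map f) (filterᵇ-cong h xs))))

  length-↭-map : length zs ≡ length xs
  length-↭-map = trans (↭-length zs↭) (length-map f xs)

none-true : {p : A → Bool} → ∀ xs → (∀ x → p x ≡ false) → any p xs ≡ false
none-true []       _ = refl
none-true (x ∷ xs) h rewrite h x = none-true xs h

𝟙 : Bool → ℕ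
𝟙 true  = 1
𝟙 false = 0

act : Permutation′ n → Subset n → Subset n
act π S = tabulate (lookup S ∘ (π ⟨$⟩ˡ_))

lookup-act : (π : Permutation′ n) (S : Subset n) (i : Fin n) → lookup (act π S) i ≡ lookup S (π ⟨$⟩ˡ i)
lookup-act π S = lookup∘tabulate _

lookup-ext : {u v : Vec Bool n} → (∀ i → lookup u i ≡ lookup v i) → u ≡ v
lookup-ext {u = u} {v} h = trans (sym (tabulate∘lookup u)) (trans (tabulate-cong h) (tabulate∘lookup v))

act-∘ : (ρ σ : Permutation′ n) (u : Subset n) → act σ (act ρ u) ≡ act (ρ ∘ₚ σ) u
act-∘ ρ σ u = tabulate-cong (lookup-act ρ u ∘ (σ ⟨$⟩ˡ_))

act-inverseˡ : (π : Permutation′ n) (u : Subset n) → act (flip π) (act π u) ≡ u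
act-inverseˡ π u = lookup-ext λ i →
  trans (lookup-act (flip π) (act π u) i) (trans (lookup-act π u _) (cong (lookup u) (inverseˡ π)))

act-inverseʳ : (π : Permutation′ n) (u : Subset n) → act π (act (flip π) u) ≡ u
act-inverseʳ π u = lookup-ext λ i →
  trans (lookup-act π (act (flip π) u) i) (trans (lookup-act (flip π) u _) (cong (lookup u) (inverseʳ π)))

act-injective : (π : Permutation′ n) {u v : Subset n} → act π u ≡ act π v → u ≡ v
act-injective π {u} {v} e = trans (sym (act-inverseˡ π u)) (trans (cong (act (flip π)) e) (act-inverseˡ π v))

act-∩ : (π : Permutation′ n) (u v : Subset n) → act π (u ∩ v) ≡ act π u ∩ act π v
act-∩ π u v = lookup-ext λ i → begin
  lookup (act π (u ∩ v)) i                          ≡⟨ lookup-act π (u ∩ v) i ⟩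
  lookup (u ∩ v) (π ⟨$⟩ˡ i)                          ≡⟨ lookup-zipWith _∧_ _ u v ⟩
  lookup u (π ⟨$⟩ˡ i) ∧ lookup v (π ⟨$⟩ˡ i)          ≡⟨ cong₂ _∧_ (lookup-act π u i) (lookup-act π v i) ⟨
  lookup (act π u) i ∧ lookup (act π v) i           ≡⟨ lookup-zipWith _∧_ i (act π u) (act π v) ⟨
  lookup (act π u ∩ act π v) i                      ∎
  where open ≡-Reasoning

act-full : (π : Permutation′ n) → act π (replicate n true) ≡ replicate n true
act-full π = lookup-ext λ i →
  trans (lookup-act π (replicate _ true) i) (trans (lookup-replicate (π ⟨$⟩ˡ i) true) (sym (lookup-replicate i true)))

lookup-singleton : (i j : Fin n) → lookup (singleton i) j ≡ true → i ≡ j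
lookup-singleton zero    zero    _ = refl
lookup-singleton zero    (suc j) e with () ← trans (sym (lookup-replicate j false)) e
lookup-singleton (suc i) (suc j) e = cong suc (lookup-singleton i j e)

lookup-singleton-self : (i : Fin n) → lookup (singleton i) i ≡ true
lookup-singleton-self zero    = refl
lookup-singleton-self (suc i) = lookup-singleton-self i

act-singleton : (π : Permutation′ n) (i : Fin n) → act π (singleton i) ≡ singleton (π ⟨$⟩ʳ i)
act-singleton π i = lookup-ext λ j → trans (lookup-act π (singleton i) j) (true⇔true⇒≡
  (λ e → subst (λ k → lookup (singleton (π ⟨$⟩ʳ i)) k ≡ true)
           (trans (cong (π ⟨$⟩ʳ_) (lookup-singleton i (π ⟨$⟩ˡ j) e)) (inverseʳ π)) (lookup-singleton-self (π ⟨$⟩ʳ i)))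
  (λ e → subst (λ k → lookup (singleton i) k ≡ true)
           (trans (sym (inverseˡ π)) (cong (π ⟨$⟩ˡ_) (lookup-singleton (π ⟨$⟩ʳ i) j e))) (lookup-singleton-self i)))

∣∣≡∑ : (u : Subset n) → ∣ u ∣ ≡ ∑ (𝟙 ∘ lookup u)
∣∣≡∑ []          = refl
∣∣≡∑ (true ∷ u)  = cong suc (∣∣≡∑ u)
∣∣≡∑ (false ∷ u) = ∣∣≡∑ u

∣act∣≡∣∣ : (π : Permutation′ n) (u : Subset n) → ∣ act π u ∣ ≡ ∣ u ∣
∣act∣≡∣∣ π u = begin
  ∣ act π u ∣                      ≡⟨ ∣∣≡∑ (act π u) ⟩
  ∑ (𝟙 ∘ lookup (act π u))         ≡⟨ sum-cong-≗ (cong 𝟙 ∘ lookup-act π u) ⟩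
  ∑ (𝟙 ∘ lookup u ∘ (π ⟨$⟩ˡ_))     ≡⟨ sum-permute (𝟙 ∘ lookup u) (flip π) ⟨
  ∑ (𝟙 ∘ lookup u)                 ≡⟨ ∣∣≡∑ u ⟨
  ∣ u ∣                            ∎
  where open ≡-Reasoning

emptyᵇ-act : (π : Permutation′ n) (u : Subset n) → emptyᵇ (act π u) ≡ emptyᵇ u
emptyᵇ-act π u = cong (_≡ᵇ 0) (∣act∣≡∣∣ π u)

eqᵇ-refl : (u : Vec Bool n) → eqᵇ u u ≡ true
eqᵇ-refl []          = refl
eqᵇ-refl (true ∷ u)  = eqᵇ-refl u
eqᵇ-refl (false ∷ u) = eqᵇ-refl u

eqᵇ⇒≡ : (u v : Vec Bool n) → eqᵇ u v ≡ true → u ≡ v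
eqᵇ⇒≡ []          []          _ = refl
eqᵇ⇒≡ (true ∷ u)  (true ∷ v)  e = cong (true ∷_) (eqᵇ⇒≡ u v e)
eqᵇ⇒≡ (false ∷ u) (false ∷ v) e = cong (false ∷_) (eqᵇ⇒≡ u v e)

≢⇒eqᵇ≡false : {u v : Vec Bool n} → ¬ u ≡ v → eqᵇ u v ≡ false
≢⇒eqᵇ≡false {u = u} {v} u≢v with eqᵇ u v in e
... | true  = ⊥-elim (u≢v (eqᵇ⇒≡ u v e))
... | false = refl

eqᵇ-act : (π : Permutation′ n) (u v : Subset n) → eqᵇ (act π u) (act π v) ≡ eqᵇ u v
eqᵇ-act π u v = true⇔true⇒≡
  (λ e → subst (λ w → eqᵇ u w ≡ true) (act-injective π (eqᵇ⇒≡ _ _ e)) (eqᵇ-refl u))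
  (λ e → subst (λ w → eqᵇ (act π u) (act π w) ≡ true) (eqᵇ⇒≡ u v e) (eqᵇ-refl (act π u)))

⊆ᵇ≡eqᵇ∩ : (u v : Vec Bool n) → ⊆ᵇ u v ≡ eqᵇ (u ∩ v) u
⊆ᵇ≡eqᵇ∩ []          []          = refl
⊆ᵇ≡eqᵇ∩ (true ∷ u)  (true ∷ v)  = ⊆ᵇ≡eqᵇ∩ u v
⊆ᵇ≡eqᵇ∩ (true ∷ u)  (false ∷ v) = refl
⊆ᵇ≡eqᵇ∩ (false ∷ u) (b ∷ v)     = ⊆ᵇ≡eqᵇ∩ u v

⊆ᵇ-act : (π : Permutation′ n) (u v : Subset n) → ⊆ᵇ (act π u) (act π v) ≡ ⊆ᵇ u v
⊆ᵇ-act π u v = begin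
  ⊆ᵇ (act π u) (act π v)               ≡⟨ ⊆ᵇ≡eqᵇ∩ (act π u) (act π v) ⟩
  eqᵇ (act π u ∩ act π v) (act π u)    ≡⟨ cong (λ w → eqᵇ w (act π u)) (act-∩ π u v) ⟨
  eqᵇ (act π (u ∩ v)) (act π u)        ≡⟨ eqᵇ-act π (u ∩ v) u ⟩
  eqᵇ (u ∩ v) u                        ≡⟨ ⊆ᵇ≡eqᵇ∩ u v ⟨
  ⊆ᵇ u v                               ∎
  where open ≡-Reasoning

⊂ᵇ-act : (π : Permutation′ n) (u v : Subset n) → ⊂ᵇ (act π u) (act π v) ≡ ⊂ᵇ u v
⊂ᵇ-act π u v = cong₂ (λ a b → a ∧ not b) (⊆ᵇ-act π u v) (eqᵇ-act π u v)

allFinᵇ⁻ : (f : Fin n → Bool) → allFinᵇ n f ≡ true → ∀ i → f i ≡ true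
allFinᵇ⁻ f e zero    with f zero | e
... | true | _ = refl
allFinᵇ⁻ f e (suc i) with f zero | e
... | true | e′ = allFinᵇ⁻ (f ∘ suc) e′ i

allFinᵇ⁺ : (f : Fin n → Bool) → (∀ i → f i ≡ true) → allFinᵇ n f ≡ true
allFinᵇ⁺ {0}     f h = refl
allFinᵇ⁺ {suc n} f h rewrite h zero = allFinᵇ⁺ (f ∘ suc) (h ∘ suc)

allFinᵇ-permute : (π : Permutation′ n) (f : Fin n → Bool) → allFinᵇ n (f ∘ (π ⟨$⟩ʳ_)) ≡ allFinᵇ n f
allFinᵇ-permute π f = true⇔true⇒≡
  (λ e → allFinᵇ⁺ f λ i → subst (λ j → f j ≡ true) (inverseʳ π) (allFinᵇ⁻ (f ∘ (π ⟨$⟩ʳ_)) e (π ⟨$⟩ˡ i)))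
  (λ e → allFinᵇ⁺ (f ∘ (π ⟨$⟩ʳ_)) λ i → allFinᵇ⁻ f e (π ⟨$⟩ʳ i))

allFinᵇ-cong : {f g : Fin n → Bool} → (∀ i → f i ≡ g i) → allFinᵇ n f ≡ allFinᵇ n g
allFinᵇ-cong {0}     h = refl
allFinᵇ-cong {suc n} h = cong₂ _∧_ (h zero) (allFinᵇ-cong (h ∘ suc))

extensions : Vec Bool m → List (Vec Bool (suc m))
extensions v = (true ∷ v) ∷ (false ∷ v) ∷ []

∈-extensions⁺ : ∀ b {v : Vec Bool m} vs → v ∈ vs → (b ∷ v) ∈ concatMap extensions vs
∈-extensions⁺ true  (_ ∷ _)  (here refl) = here refl
∈-extensions⁺ false (_ ∷ _)  (here refl) = there (here refl)
∈-extensions⁺ b     (_ ∷ vs) (there v∈)  = there (there (∈-extensions⁺ b vs v∈))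

∈-extensions⁻ : ∀ b {v : Vec Bool m} vs → (b ∷ v) ∈ concatMap extensions vs → v ∈ vs
∈-extensions⁻ b (_ ∷ _)  (here refl)         = here refl
∈-extensions⁻ b (_ ∷ _)  (there (here refl)) = here refl
∈-extensions⁻ b (_ ∷ vs) (there (there v∈))  = there (∈-extensions⁻ b vs v∈)

∈-allVec : (v : Vec Bool m) → v ∈ allVec m
∈-allVec []      = here refl
∈-allVec (b ∷ v) = ∈-extensions⁺ b _ (∈-allVec v)

unique-extensions : (vs : List (Vec Bool m)) → Unique vs → Unique (concatMap extensions vs)
unique-extensions []       []         = []
unique-extensions (v ∷ vs) (v∉ ∷ uvs) =
  ((λ ()) ∷ All.tabulate (fresh true)) ∷ All.tabulate (fresh false) ∷ unique-extensions vs uvs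
  where
  fresh : ∀ b {w} → w ∈ concatMap extensions vs → (b ∷ v) ≢ w
  fresh b w∈ refl = All.lookup v∉ (∈-extensions⁻ b vs w∈) refl

unique-allVec : (m : ℕ) → Unique (allVec m)
unique-allVec zero    = [] ∷ []
unique-allVec (suc m) = unique-extensions (allVec m) (unique-allVec m)

subsets-↭-act : (π : Permutation′ m) → subsets m ↭ map (act π) (subsets m)
subsets-↭-act {m} π = unique-sameElements⇒↭ (unique-allVec m) (Unique.map⁺ (act-injective π) (unique-allVec m))
  (λ {X} _ → subst (_∈ map (act π) (subsets m)) (act-inverseʳ π X) (∈-map⁺ (act π) (∈-allVec (act (flip π) X))))
  (λ _ → ∈-allVec _)

∈⇒memᵇ : {B : Subset n} {L : List (Subset n)} → B ∈ L → memᵇ B L ≡ true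
∈⇒memᵇ {B = B} B∈ = any-true⁺ (eqᵇ B) B∈ (eqᵇ-refl B)

memᵇ⇒∈ : {B : Subset n} {L : List (Subset n)} → memᵇ B L ≡ true → B ∈ L
memᵇ⇒∈ {B = B} {L} e with C , C∈ , B≈C ← any-true⁻ (eqᵇ B) L e = subst (_∈ L) (sym (eqᵇ⇒≡ B C B≈C)) C∈

∉⇒memᵇ≡false : {B : Subset n} {L : List (Subset n)} → B ∉ L → memᵇ B L ≡ false
∉⇒memᵇ≡false {B = B} {L} B∉ with memᵇ B L in e
... | true  = ⊥-elim (B∉ (memᵇ⇒∈ e))
... | false = refl

memᵇ-filterᵇ : (g : Subset n → Bool) (B : Subset n) → memᵇ B (filterᵇ g (subsets n)) ≡ g B
memᵇ-filterᵇ {n} g B = true⇔true⇒≡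
  (λ e → proj₂ (∈-filterᵇ⁻ g {subsets n} (memᵇ⇒∈ e)))
  (λ e → ∈⇒memᵇ (∈-filterᵇ⁺ g (∈-allVec B) e))

fromPredicate : (Subset n → Bool) → Family n
fromPredicate {n} g = fam (Vec.map g (fromList (subsets n)))

selected : List A → List Bool → List A
selected L bs = map proj₁ (filterᵇ proj₂ (zip L bs))

selected-map : (g : A → Bool) (L : List A) → selected L (toList (Vec.map g (fromList L))) ≡ filterᵇ g L
selected-map g []      = refl
selected-map g (x ∷ L) with g x
... | true  = cong (x ∷_) (selected-map g L)
... | false = selected-map g L

selected-⊆ : (L : List A) (bs : List Bool) {y : A} → y ∈ selected L bs → y ∈ L
selected-⊆ (x ∷ L) (true ∷ bs)  (here refl) = here refl
selected-⊆ (x ∷ L) (true ∷ bs)  (there y∈)  = there (selected-⊆ L bs y∈)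
selected-⊆ (x ∷ L) (false ∷ bs) y∈          = there (selected-⊆ L bs y∈)

map-fromList-cong-∈ : {g h : A → Bool} (L : List A) →
  (∀ {x} → x ∈ L → g x ≡ h x) → Vec.map g (fromList L) ≡ Vec.map h (fromList L)
map-fromList-cong-∈ []      _ = refl
map-fromList-cong-∈ (x ∷ L) h = cong₂ _∷_ (h (here refl)) (map-fromList-cong-∈ L (h ∘ there))

membership-selected : (L : List (Subset n)) → Unique L → (bs : Vec Bool (length L)) →
  Vec.map (λ B → memᵇ B (selected L (toList bs))) (fromList L) ≡ bs
membership-selected []      _           []           = refl
membership-selected (x ∷ L) (x∉ ∷ uL)  (true ∷ bs)  =
  cong₂ _∷_ (cong (_∨ memᵇ x (selected L (toList bs))) (eqᵇ-refl x))
    (trans (map-fromList-cong-∈ L λ {y} y∈ →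
              cong (_∨ memᵇ y (selected L (toList bs))) (≢⇒eqᵇ≡false (λ y≡x → All.lookup x∉ y∈ (sym y≡x))))
           (membership-selected L uL bs))
membership-selected (x ∷ L) (x∉ ∷ uL)  (false ∷ bs) =
  cong₂ _∷_ (∉⇒memᵇ≡false (λ x∈ → All.lookup x∉ (selected-⊆ L (toList bs) x∈) refl)) (membership-selected L uL bs)

clusters-fromPredicate : (g : Subset n → Bool) → clusters (fromPredicate g) ≡ filterᵇ g (subsets n)
clusters-fromPredicate {n} g = selected-map g (subsets n)

fromPredicate-memᵇ-clusters : (F : Family n) → fromPredicate (λ B → memᵇ B (clusters F)) ≡ F
fromPredicate-memᵇ-clusters {n} F = cong fam (membership-selected (subsets n) (unique-allVec n) (bits F))

fromPredicate-cong : {g h : Subset n → Bool} → g ≗ h → fromPredicate g ≡ fromPredicate h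
fromPredicate-cong g≗h = cong fam (Vecₚ.map-cong g≗h _)

filterᵇ-memᵇ-clusters : (F : Family n) → filterᵇ (λ B → memᵇ B (clusters F)) (subsets n) ≡ clusters F
filterᵇ-memᵇ-clusters F =
  trans (sym (clusters-fromPredicate (λ B → memᵇ B (clusters F)))) (cong clusters (fromPredicate-memᵇ-clusters F))

-- resolvedᵇ F X is, by definition, resolvedIn (restrClusters F X).
resolvedIn : List (Subset n) → Bool
resolvedIn rs = all (λ Y → if 2 ≤ᵇ ∣ Y ∣ then length (childrenIn Y) ≡ᵇ 2 else true) rs
  where childrenIn = λ Y → filterᵇ (λ Z → ⊂ᵇ Z Y ∧ not (any (λ W → ⊂ᵇ Z W ∧ ⊂ᵇ W Y) rs)) rs

resolvedIn-↭-map : {m : ℕ} {f : Subset m → Subset n} {rs : List (Subset n)} {qs : List (Subset m)} →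
  rs ↭ map f qs → (∀ u v → ⊂ᵇ (f u) (f v) ≡ ⊂ᵇ u v) → (∀ u → ∣ f u ∣ ≡ ∣ u ∣) → resolvedIn rs ≡ resolvedIn qs
resolvedIn-↭-map rs↭ f-⊂ᵇ f-∣∣ = all-↭-map rs↭ λ Y →
  cong₂ (λ k c → if 2 ≤ᵇ k then c ≡ᵇ 2 else true) (f-∣∣ Y) (length-↭-map (filterᵇ-↭-map rs↭ λ Z →
    cong₂ (λ a b → a ∧ not b) (f-⊂ᵇ Z Y) (any-↭-map rs↭ λ W → cong₂ _∧_ (f-⊂ᵇ Z W) (f-⊂ᵇ W Y))))

actF : Permutation′ n → Family n → Family n
actF π F = fromPredicate (λ B → memᵇ (act (flip π) B) (clusters F))

clusters-actF : (π : Permutation′ n) (F : Family n) → clusters (actF π F) ↭ map (act π) (clusters F)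
clusters-actF {n} π F = ↭-trans (↭-reflexive (clusters-fromPredicate g))
  (↭-trans (filterᵇ-↭-map (subsets-↭-act π) (λ B → cong (λ C → memᵇ C (clusters F)) (act-inverseˡ π B)))
           (↭-reflexive (cong (map (act π)) (filterᵇ-memᵇ-clusters F))))
  where
  g : Subset n → Bool
  g B = memᵇ (act (flip π) B) (clusters F)

actF-inverseʳ : (π : Permutation′ n) (G : Family n) → actF π (actF (flip π) G) ≡ G
actF-inverseʳ {n} π G = trans (fromPredicate-cong λ B → begin
    memᵇ (act (flip π) B) (clusters (actF (flip π) G))
      ≡⟨ cong (memᵇ (act (flip π) B)) (clusters-fromPredicate _) ⟩
    memᵇ (act (flip π) B) (filterᵇ (λ C → memᵇ (act π C) (clusters G)) (subsets n))
      ≡⟨ memᵇ-filterᵇ _ (act (flip π) B) ⟩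
    memᵇ (act π (act (flip π) B)) (clusters G)
      ≡⟨ cong (λ C → memᵇ C (clusters G)) (act-inverseʳ π B) ⟩
    memᵇ B (clusters G) ∎)
  (fromPredicate-memᵇ-clusters G)
  where open ≡-Reasoning

actF-injective : (π : Permutation′ n) {F G : Family n} → actF π F ≡ actF π G → F ≡ G
actF-injective π {F} {G} e =
  trans (sym (actF-inverseʳ (flip π) F)) (trans (cong (actF (flip π)) e) (actF-inverseʳ (flip π) G))

module Invariance (π : Permutation′ n) where

  inRestrᵇ-act : (F : Family n) (X Y : Subset n) → inRestrᵇ (actF π F) (act π X) (act π Y) ≡ inRestrᵇ F X Y
  inRestrᵇ-act F X Y = cong₂ _∧_ (cong not (emptyᵇ-act π Y)) (any-↭-map (clusters-actF π F) λ C →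
    trans (cong (λ D → eqᵇ D (act π Y)) (sym (act-∩ π C X))) (eqᵇ-act π (C ∩ X) Y))

  restrClusters-act : (F : Family n) (X : Subset n) →
    restrClusters (actF π F) (act π X) ↭ map (act π) (restrClusters F X)
  restrClusters-act F X = filterᵇ-↭-map (subsets-↭-act π) (inRestrᵇ-act F X)

  resolvedᵇ-act : (F : Family n) (X : Subset n) → resolvedᵇ (actF π F) (act π X) ≡ resolvedᵇ F X
  resolvedᵇ-act F X = resolvedIn-↭-map (restrClusters-act F X) (⊂ᵇ-act π) (∣act∣≡∣∣ π)

  sameRestrᵇ-act : (F G : Family n) (X : Subset n) → sameRestrᵇ (actF π F) (actF π G) (act π X) ≡ sameRestrᵇ F G X
  sameRestrᵇ-act F G X = all-↭-map (subsets-↭-act π) λ Y →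
    cong₂ (λ a b → eqᵇ (a ∷ []) (b ∷ [])) (inRestrᵇ-act F X Y) (inRestrᵇ-act G X Y)

  isPhylogeny-act : (F : Family n) → isPhylogeny (actF π F) ≡ isPhylogeny F
  isPhylogeny-act F = cong₂ _∧_ nonempty (cong₂ _∧_ full (cong₂ _∧_ singletons compatible))
    where
    cs cs′ : List (Subset n)
    cs  = clusters F
    cs′ = clusters (actF π F)
    cs↭ : cs′ ↭ map (act π) cs
    cs↭ = clusters-actF π F
    nonempty : all (λ C → not (emptyᵇ C)) cs′ ≡ all (λ C → not (emptyᵇ C)) cs
    nonempty = all-↭-map cs↭ λ C → cong not (emptyᵇ-act π C)
    full : memᵇ (replicate n true) cs′ ≡ memᵇ (replicate n true) cs
    full = any-↭-map cs↭ λ C →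
      trans (cong (λ D → eqᵇ D (act π C)) (sym (act-full π))) (eqᵇ-act π (replicate n true) C)
    singleton-act : (i : Fin n) → memᵇ (singleton i) cs′ ≡ memᵇ (singleton (π ⟨$⟩ˡ i)) cs
    singleton-act i = any-↭-map cs↭ λ C →
      trans (cong (λ D → eqᵇ D (act π C))
                  (trans (cong singleton (sym (inverseʳ π))) (sym (act-singleton π (π ⟨$⟩ˡ i)))))
            (eqᵇ-act π (singleton (π ⟨$⟩ˡ i)) C)
    singletons : allFinᵇ n (λ i → memᵇ (singleton i) cs′) ≡ allFinᵇ n (λ i → memᵇ (singleton i) cs)
    singletons = trans (allFinᵇ-cong singleton-act) (allFinᵇ-permute (flip π) (λ i → memᵇ (singleton i) cs))
    compatibleᵇ-act : (A B : Subset n) → compatibleᵇ (act π A) (act π B) ≡ compatibleᵇ A B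
    compatibleᵇ-act A B = cong₂ _∨_ (⊆ᵇ-act π A B) (cong₂ _∨_ (⊆ᵇ-act π B A)
      (trans (cong emptyᵇ (sym (act-∩ π A B))) (emptyᵇ-act π (A ∩ B))))
    compatible : all (λ A → all (compatibleᵇ A) cs′) cs′ ≡ all (λ A → all (compatibleᵇ A) cs) cs
    compatible = all-↭-map cs↭ λ A → all-↭-map cs↭ λ B → compatibleᵇ-act A B

∈-RP⁺ : {F : Family n} → isPhylogeny F ≡ true → F ∈ RP n
∈-RP⁺ {n} {fam bs} = ∈-filterᵇ⁺ isPhylogeny (∈-map⁺ fam (∈-allVec bs))

∈-RP⁻ : {F : Family n} → F ∈ RP n → isPhylogeny F ≡ true
∈-RP⁻ {n} F∈ = proj₂ (∈-filterᵇ⁻ isPhylogeny {map fam (allVec (length (subsets n)))} F∈)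

unique-RP : (n : ℕ) → Unique (RP n)
unique-RP n = Unique.filter⁺ (T? ∘ isPhylogeny) (Unique.map⁺ (λ { refl → refl }) (unique-allVec (length (subsets n))))

RP-↭-actF : (π : Permutation′ n) → RP n ↭ map (actF π) (RP n)
RP-↭-actF {n} π = unique-sameElements⇒↭ (unique-RP n) (Unique.map⁺ (actF-injective π) (unique-RP n))
  (λ {G} G∈ → subst (_∈ map (actF π) (RP n)) (actF-inverseʳ π G)
     (∈-map⁺ (actF π) (∈-RP⁺ (trans (Invariance.isPhylogeny-act (flip π) G) (∈-RP⁻ G∈)))))
  image⊆RP
  where
  image⊆RP : ∀ {G} → G ∈ map (actF π) (RP n) → G ∈ RP n
  image⊆RP G∈ with F , F∈ , refl ← ∈-map⁻ (actF π) G∈ = ∈-RP⁺ (trans (Invariance.isPhylogeny-act π F) (∈-RP⁻ F∈))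

sum-RP-actF : (π : Permutation′ n) (h : Family n → ℕ) → sum (map h (RP n)) ≡ sum (map (h ∘ actF π) (RP n))
sum-RP-actF {n} π h = trans (sum-↭ (map⁺ h (RP-↭-actF π))) (cong sum (sym (map-∘ (RP n))))

-- Subsets of equal size lie in one orbit

act-lift₀ : (ρ : Permutation′ n) (a : Bool) (u : Subset n) → act (lift₀ ρ) (a ∷ u) ≡ a ∷ act ρ u
act-lift₀ ρ a u = lookup-ext λ where
  zero    → lookup-act (lift₀ ρ) (a ∷ u) zero
  (suc i) → trans (lookup-act (lift₀ ρ) (a ∷ u) (suc i)) (sym (lookup-act ρ u i))

act-meet : (ρ σ : Permutation′ n) {A B C : Subset n} → act ρ A ≡ C → act σ B ≡ C → act (ρ ∘ₚ flip σ) A ≡ B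
act-meet ρ σ {A} {B} ρA≡C σB≡C =
  trans (sym (act-∘ ρ (flip σ) A)) (trans (cong (act (flip σ)) (trans ρA≡C (sym σB≡C))) (act-inverseˡ σ B))

member-of-nonempty : ∀ {k} (u : Subset n) → ∣ u ∣ ≡ suc k → ∃ λ j → lookup u j ≡ true
member-of-nonempty (true ∷ u)  _ = zero , refl
member-of-nonempty (false ∷ u) e with j , uj ← member-of-nonempty u e = suc j , uj

move-to-front : (u : Subset (suc n)) (j : Fin (suc n)) → lookup u j ≡ true →
  ∃₂ λ σ u′ → act σ u ≡ true ∷ u′ × suc ∣ u′ ∣ ≡ ∣ u ∣
move-to-front {n} u j uj = σ , tail (act σ u) , σu≡ , trans (cong ∣_∣ (sym σu≡)) (∣act∣≡∣∣ σ u)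
  where
  σ : Permutation′ (suc n)
  σ = transpose j zero  -- not `transpose zero j`: this way σ ⟨$⟩ˡ zero reduces to j
  σu≡ : act σ u ≡ true ∷ tail (act σ u)
  σu≡ = head-true (act σ u) (trans (lookup-act σ u zero) uj)
    where
    head-true : (v : Subset (suc n)) → lookup v zero ≡ true → v ≡ true ∷ tail v
    head-true (b ∷ w) refl = refl

equal-size⇒act : (A B : Subset n) → ∣ A ∣ ≡ ∣ B ∣ → ∃ λ π → act π A ≡ B
equal-size⇒act [] [] _ = id , refl
equal-size⇒act (true ∷ A) (true ∷ B) e with ρ , ρA≡B ← equal-size⇒act A B (suc-injective e) =
  lift₀ ρ , trans (act-lift₀ ρ true A) (cong (true ∷_) ρA≡B)
equal-size⇒act (false ∷ A) (false ∷ B) e with ρ , ρA≡B ← equal-size⇒act A B e =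
  lift₀ ρ , trans (act-lift₀ ρ false A) (cong (false ∷_) ρA≡B)
equal-size⇒act (true ∷ A) (false ∷ B) e
  with j , Bj ← member-of-nonempty B (sym e)
  with σ , B′ , σB≡ , ∣B′∣ ← move-to-front (false ∷ B) (suc j) Bj
  with ρ , ρA≡B′ ← equal-size⇒act A B′ (suc-injective (trans e (sym ∣B′∣))) =
  lift₀ ρ ∘ₚ flip σ , act-meet (lift₀ ρ) σ {true ∷ A} (trans (act-lift₀ ρ true A) (cong (true ∷_) ρA≡B′)) σB≡
equal-size⇒act (false ∷ A) (true ∷ B) e
  with j , Aj ← member-of-nonempty A e
  with σ , A′ , σA≡ , ∣A′∣ ← move-to-front (false ∷ A) (suc j) Aj
  with ρ , ρB≡A′ ← equal-size⇒act B A′ (suc-injective (trans (sym e) (sym ∣A′∣))) =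
  σ ∘ₚ flip (lift₀ ρ) , act-meet σ (lift₀ ρ) {false ∷ A} σA≡ (trans (act-lift₀ ρ true B) (cong (true ∷_) ρB≡A′))

-- Counting pairs of phylogenies triplet by triplet

-- Natural-number arithmetic is opened only inside this module, so that outside it `_+_`, `_*_` are
-- the rational operations of the statement.
module Counting where

  open import Algebra.Properties.CommutativeSemigroup as CommSemigroupProps using ()
  open import Data.Bool.Properties using (∧-zeroʳ; ∧-identityʳ; ∧-assoc; ∧-conicalˡ; ∧-conicalʳ)
  open import Data.Fin.Subset.Properties using (∩-zeroʳ; ∩-identityʳ; ∣⊥∣≡0)
  open import Data.Nat using (_+_; _*_)
  open import Data.Nat.Combinatorics using (nCk+nC[k+1]≡[n+1]C[k+1]) renaming (_C_ to _choose_)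
  open import Data.Nat.Properties
    using (+-assoc; +-identityʳ; +-commutativeSemigroup; *-distribˡ-+; *-distribʳ-+; *-zeroʳ; *-identityʳ; ≡ᵇ⇒≡)
  open import Data.Vec using (_++_)
  open import Data.Vec.Properties using (++-injectiveˡ)

  open CommSemigroupProps +-commutativeSemigroup using (interchange)

  length-filterᵇ : (p : A → Bool) → ∀ xs → length (filterᵇ p xs) ≡ sum (map (𝟙 ∘ p) xs)
  length-filterᵇ p []       = refl
  length-filterᵇ p (x ∷ xs) with p x
  ... | true  = cong suc (length-filterᵇ p xs)
  ... | false = length-filterᵇ p xs

  sum-cong-∈ : {f g : A → ℕ} → ∀ xs → (∀ {x} → x ∈ xs → f x ≡ g x) → sum (map f xs) ≡ sum (map g xs)
  sum-cong-∈ xs h = cong sum (map-cong-local (All.tabulate h))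

  sum-map-+ : (f g : A → ℕ) → ∀ xs → sum (map (λ x → f x + g x) xs) ≡ sum (map f xs) + sum (map g xs)
  sum-map-+ f g []       = refl
  sum-map-+ f g (x ∷ xs) = trans (cong (f x + g x +_) (sum-map-+ f g xs)) (interchange (f x) (g x) _ _)

  sum-map-*ˡ : (c : ℕ) (f : A → ℕ) → ∀ xs → sum (map (λ x → c * f x) xs) ≡ c * sum (map f xs)
  sum-map-*ˡ c f []       = sym (*-zeroʳ c)
  sum-map-*ˡ c f (x ∷ xs) = trans (cong (c * f x +_) (sum-map-*ˡ c f xs)) (sym (*-distribˡ-+ c (f x) _))

  sum-const : (f : A → ℕ) (c : ℕ) → ∀ xs → (∀ {x} → x ∈ xs → f x ≡ c) → sum (map f xs) ≡ length xs * c
  sum-const f c []       _ = refl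
  sum-const f c (x ∷ xs) h = cong₂ _+_ (h (here refl)) (sum-const f c xs (h ∘ there))

  sum-sum-* : (f : A → ℕ) (g : B → ℕ) → ∀ as bs →
    sum (map (λ a → sum (map (λ b → f a * g b) bs)) as) ≡ sum (map f as) * sum (map g bs)
  sum-sum-* f g []       bs = refl
  sum-sum-* f g (a ∷ as) bs =
    trans (cong₂ _+_ (sum-map-*ˡ (f a) g bs) (sum-sum-* f g as bs)) (sym (*-distribʳ-+ _ (f a) _))

  sum-comm : (f : A → B → ℕ) → ∀ as bs →
    sum (map (λ a → sum (map (f a) bs)) as) ≡ sum (map (λ b → sum (map (λ a → f a b) as)) bs)
  sum-comm f []       bs = sym (trans (sum-const (λ _ → 0) 0 bs (λ _ → refl)) (*-zeroʳ (length bs)))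
  sum-comm f (a ∷ as) bs =
    trans (cong (sum (map (f a) bs) +_) (sum-comm f as bs)) (sym (sum-map-+ (f a) _ bs))

  sum-sum-+ : (f g : A → B → ℕ) → ∀ as bs →
    sum (map (λ a → sum (map (λ b → f a b + g a b) bs)) as)
      ≡ sum (map (λ a → sum (map (f a) bs)) as) + sum (map (λ a → sum (map (g a) bs)) as)
  sum-sum-+ f g as bs = trans (cong sum (map-cong (λ a → sum-map-+ (f a) (g a) bs) as)) (sum-map-+ _ _ as)

  𝟙-∧ : ∀ x y → 𝟙 (x ∧ y) ≡ 𝟙 x * 𝟙 y
  𝟙-∧ true  y = sym (+-identityʳ (𝟙 y))
  𝟙-∧ false y = refl

  𝟙-+-𝟙-not : ∀ x → 𝟙 x + 𝟙 (not x) ≡ 1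
  𝟙-+-𝟙-not true  = refl
  𝟙-+-𝟙-not false = refl

  ∑RP : (Family n → ℕ) → ℕ
  ∑RP {n} h = sum (map h (RP n))

  TripletPredicate : ℕ → Set
  TripletPredicate n = Family n → Family n → Subset n → Bool

  pairCount : TripletPredicate n → Subset n → ℕ
  pairCount φ X = ∑RP λ F → ∑RP λ G → 𝟙 (φ F G X)

  Invariant : TripletPredicate n → Set
  Invariant {n} φ = ∀ (π : Permutation′ n) F G X → φ (actF π F) (actF π G) (act π X) ≡ φ F G X

  pairCount-act : {φ : TripletPredicate n} → Invariant φ → (π : Permutation′ n) (X : Subset n) →
    pairCount φ (act π X) ≡ pairCount φ X
  pairCount-act {n} {φ} inv π X =
    trans (sum-RP-actF π _)
      (sum-cong-∈ (RP n) λ {F} _ → trans (sum-RP-actF π _)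
        (sum-cong-∈ (RP n) λ {G} _ → cong 𝟙 (inv π F G X)))

  sum-pairs-count-orbit : {φ : TripletPredicate n} → Invariant φ → (Xs : List (Subset n)) (X₀ : Subset n) →
    (∀ {X} → X ∈ Xs → ∃ λ π → act π X₀ ≡ X) →
    (∑RP λ F → ∑RP λ G → length (filterᵇ (φ F G) Xs)) ≡ length Xs * pairCount φ X₀
  sum-pairs-count-orbit {n} {φ} inv Xs X₀ orbit = begin
    (∑RP λ F → ∑RP λ G → length (filterᵇ (φ F G) Xs))
      ≡⟨ sum-cong-∈ (RP n) (λ {F} _ → sum-cong-∈ (RP n) λ {G} _ → length-filterᵇ (φ F G) Xs) ⟩
    (∑RP λ F → ∑RP λ G → sum (map (λ X → 𝟙 (φ F G X)) Xs))
      ≡⟨ sum-cong-∈ (RP n) (λ {F} _ → sum-comm (λ G X → 𝟙 (φ F G X)) (RP n) Xs) ⟩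
    (∑RP λ F → sum (map (λ X → ∑RP λ G → 𝟙 (φ F G X)) Xs))
      ≡⟨ sum-comm (λ F X → ∑RP λ G → 𝟙 (φ F G X)) (RP n) Xs ⟩
    sum (map (pairCount φ) Xs)
      ≡⟨ sum-const (pairCount φ) (pairCount φ X₀) Xs (λ X∈ → pairCount-orbit (orbit X∈)) ⟩
    length Xs * pairCount φ X₀ ∎
    where
    open ≡-Reasoning
    pairCount-orbit : ∀ {X} → (∃ λ π → act π X₀ ≡ X) → pairCount φ X ≡ pairCount φ X₀
    pairCount-orbit (π , refl) = pairCount-act inv π X₀

  sum-extensions : (f : Vec Bool (suc m) → ℕ) (vs : List (Vec Bool m)) →
    sum (map f (concatMap extensions vs)) ≡ sum (map (λ v → f (true ∷ v) + f (false ∷ v)) vs)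
  sum-extensions f []       = refl
  sum-extensions f (v ∷ vs) =
    trans (sym (+-assoc (f (true ∷ v)) _ _)) (cong (f (true ∷ v) + f (false ∷ v) +_) (sum-extensions f vs))

  number-of-subsets-of-size : ∀ m k → length (filterᵇ (λ X → ∣ X ∣ ≡ᵇ k) (subsets m)) ≡ m choose k
  number-of-subsets-of-size zero    zero    = refl
  number-of-subsets-of-size zero    (suc k) = refl
  number-of-subsets-of-size (suc m) k =
    trans (length-filterᵇ _ (allVec (suc m))) (trans (sum-extensions _ (allVec m)) (by-head k))
    where
    count : ℕ → ℕ
    count k = sum (map (λ v → 𝟙 (∣ v ∣ ≡ᵇ k)) (allVec m))

    count≡choose : ∀ k → count k ≡ m choose k
    count≡choose k = trans (sym (length-filterᵇ _ (allVec m))) (number-of-subsets-of-size m k)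

    by-head : ∀ k → sum (map (λ v → 𝟙 (∣ true ∷ v ∣ ≡ᵇ k) + 𝟙 (∣ false ∷ v ∣ ≡ᵇ k)) (allVec m)) ≡ suc m choose k
    by-head zero    = count≡choose zero
    by-head (suc k) = trans (sum-map-+ (λ v → 𝟙 (∣ v ∣ ≡ᵇ k)) (λ v → 𝟙 (∣ v ∣ ≡ᵇ suc k)) (allVec m))
      (trans (cong₂ _+_ (count≡choose k) (count≡choose (suc k))) (nCk+nC[k+1]≡[n+1]C[k+1] m k))

  differentlyResolved resolvedOnlyInFirst resolvedOnlyInSecond : TripletPredicate n
  differentlyResolved  F G X = resolvedᵇ F X ∧ resolvedᵇ G X ∧ not (sameRestrᵇ F G X)
  resolvedOnlyInFirst  F G X = resolvedᵇ F X ∧ not (resolvedᵇ G X)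
  resolvedOnlyInSecond F G X = not (resolvedᵇ F X) ∧ resolvedᵇ G X

  eqᵇ-++ : (u v : Vec Bool k) (s r : Vec Bool l) → eqᵇ (u ++ s) (v ++ r) ≡ eqᵇ u v ∧ eqᵇ s r
  eqᵇ-++ []      []      s r = refl
  eqᵇ-++ (a ∷ u) (b ∷ v) s r = trans (cong (x ∧_) (eqᵇ-++ u v s r)) (sym (∧-assoc x (eqᵇ u v) (eqᵇ s r)))
    where
    x : Bool
    x = (a ∧ b) ∨ (not a ∧ not b)

  ⊆ᵇ-++ : (u v : Vec Bool k) (s r : Vec Bool l) → ⊆ᵇ (u ++ s) (v ++ r) ≡ ⊆ᵇ u v ∧ ⊆ᵇ s r
  ⊆ᵇ-++ []      []      s r = refl
  ⊆ᵇ-++ (a ∷ u) (b ∷ v) s r = trans (cong (x ∧_) (⊆ᵇ-++ u v s r)) (sym (∧-assoc x (⊆ᵇ u v) (⊆ᵇ s r)))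
    where
    x : Bool
    x = not a ∨ b

  ∣++∣ : (u : Vec Bool k) (s : Vec Bool l) → ∣ u ++ s ∣ ≡ ∣ u ∣ + ∣ s ∣
  ∣++∣ []          s = refl
  ∣++∣ (true ∷ u)  s = cong suc (∣++∣ u s)
  ∣++∣ (false ∷ u) s = ∣++∣ u s

  ⊆ᵇ-refl : (u : Vec Bool k) → ⊆ᵇ u u ≡ true
  ⊆ᵇ-refl []          = refl
  ⊆ᵇ-refl (true ∷ u)  = ⊆ᵇ-refl u
  ⊆ᵇ-refl (false ∷ u) = ⊆ᵇ-refl u

  -- The restriction to the triplet {0, 1, 2}

  module FirstTriplet (m : ℕ) where

    N : ℕ
    N = 3 + m

    X₀ : Subset N
    X₀ = firstTriplet N

    Pattern : Set
    Pattern = Subset 3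

    patterns : List Pattern
    patterns = subsets 3

    embed : Pattern → Subset N
    embed w = w ++ ⊥

    trace : Family N → Pattern → Bool
    trace F w = inRestrᵇ F X₀ (embed w)

    embed-⊂ᵇ : (u v : Pattern) → ⊂ᵇ (embed u) (embed v) ≡ ⊂ᵇ u v
    embed-⊂ᵇ u v = cong₂ (λ a b → a ∧ not b)
      (trans (⊆ᵇ-++ u v ⊥ ⊥) (trans (cong (⊆ᵇ u v ∧_) (⊆ᵇ-refl (⊥ {m}))) (∧-identityʳ _)))
      (trans (eqᵇ-++ u v ⊥ ⊥) (trans (cong (eqᵇ u v ∧_) (eqᵇ-refl (⊥ {m}))) (∧-identityʳ _)))

    ∣embed∣ : (u : Pattern) → ∣ embed u ∣ ≡ ∣ u ∣
    ∣embed∣ u = trans (∣++∣ u ⊥) (trans (cong (∣ u ∣ +_) (∣⊥∣≡0 m)) (+-identityʳ _))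

    inRestrᵇ-X₀ : (F : Family N) (w : Pattern) (r : Vec Bool m) → inRestrᵇ F X₀ (w ++ r) ≡ eqᵇ ⊥ r ∧ trace F w
    inRestrᵇ-X₀ F w r with eqᵇ ⊥ r in ⊥≈r
    ... | true  with refl ← eqᵇ⇒≡ ⊥ r ⊥≈r = refl
    ... | false = trans (cong (_ ∧_) (none-true (clusters F) no-trace)) (∧-zeroʳ _)
      where
      no-trace : ∀ C → eqᵇ (C ∩ X₀) (w ++ r) ≡ false
      no-trace (c₀ ∷ c₁ ∷ c₂ ∷ rc) = begin
        eqᵇ (c ++ (rc ∩ ⊥)) (w ++ r)  ≡⟨ eqᵇ-++ c w (rc ∩ ⊥) r ⟩
        eqᵇ c w ∧ eqᵇ (rc ∩ ⊥) r      ≡⟨ cong (λ s → eqᵇ c w ∧ eqᵇ s r) (∩-zeroʳ rc) ⟩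
        eqᵇ c w ∧ eqᵇ ⊥ r             ≡⟨ cong (eqᵇ c w ∧_) ⊥≈r ⟩
        eqᵇ c w ∧ false               ≡⟨ ∧-zeroʳ _ ⟩
        false                         ∎
        where
        open ≡-Reasoning
        c : Pattern
        c = (c₀ ∷ c₁ ∷ c₂ ∷ []) ∩ (true ∷ true ∷ true ∷ [])

    restrClusters-X₀ : (F : Family N) → restrClusters F X₀ ↭ map embed (filterᵇ (trace F) patterns)
    restrClusters-X₀ F = unique-sameElements⇒↭
      (Unique.filter⁺ (T? ∘ inRestrᵇ F X₀) (unique-allVec N))
      (Unique.map⁺ (++-injectiveˡ _ _) (Unique.filter⁺ (T? ∘ trace F) (unique-allVec 3)))
      to from
      where
      restricted : ∀ {Y} → Y ∈ restrClusters F X₀ → inRestrᵇ F X₀ Y ≡ true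
      restricted Y∈ = proj₂ (∈-filterᵇ⁻ (inRestrᵇ F X₀) {subsets N} Y∈)
      to : ∀ {Y} → Y ∈ restrClusters F X₀ → Y ∈ map embed (filterᵇ (trace F) patterns)
      to {y₀ ∷ y₁ ∷ y₂ ∷ r} Y∈ with eqᵇ ⊥ r in ⊥≈r | inRestrᵇ-X₀ F (y₀ ∷ y₁ ∷ y₂ ∷ []) r
      ... | true  | e with refl ← eqᵇ⇒≡ ⊥ r ⊥≈r =
        ∈-map⁺ embed (∈-filterᵇ⁺ (trace F) (∈-allVec (y₀ ∷ y₁ ∷ y₂ ∷ [])) (trans (sym e) (restricted Y∈)))
      ... | false | e with () ← trans (sym e) (restricted Y∈)
      from : ∀ {Y} → Y ∈ map embed (filterᵇ (trace F) patterns) → Y ∈ restrClusters F X₀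
      from Y∈ with w , w∈ , refl ← ∈-map⁻ embed Y∈ =
        ∈-filterᵇ⁺ (inRestrᵇ F X₀) (∈-allVec (embed w)) (proj₂ (∈-filterᵇ⁻ (trace F) {patterns} w∈))

    resolvedᵇ-X₀ : (F : Family N) → resolvedᵇ F X₀ ≡ resolvedIn (filterᵇ (trace F) patterns)
    resolvedᵇ-X₀ F = resolvedIn-↭-map (restrClusters-X₀ F) embed-⊂ᵇ ∣embed∣

    sameRestrᵇ-X₀ : (F G : Family N) →
      sameRestrᵇ F G X₀ ≡ all (λ w → eqᵇ (trace F w ∷ []) (trace G w ∷ [])) patterns
    sameRestrᵇ-X₀ F G = true⇔true⇒≡
      (λ e → all-true⁺ agreeOn patterns λ {w} _ → all-true⁻ agreeOnAll e (∈-allVec (embed w)))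
      (λ e → all-true⁺ agreeOnAll (subsets N) λ {Y} _ → agree Y e)
      where
      agreeOnAll : Subset N → Bool
      agreeOnAll Y = eqᵇ (inRestrᵇ F X₀ Y ∷ []) (inRestrᵇ G X₀ Y ∷ [])
      agreeOn : Pattern → Bool
      agreeOn w = eqᵇ (trace F w ∷ []) (trace G w ∷ [])
      agree : ∀ Y → all agreeOn patterns ≡ true → agreeOnAll Y ≡ true
      agree (y₀ ∷ y₁ ∷ y₂ ∷ r) e
        rewrite inRestrᵇ-X₀ F (y₀ ∷ y₁ ∷ y₂ ∷ []) r | inRestrᵇ-X₀ G (y₀ ∷ y₁ ∷ y₂ ∷ []) r with eqᵇ ⊥ r
      ... | true  = all-true⁻ agreeOn e (∈-allVec (y₀ ∷ y₁ ∷ y₂ ∷ []))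
      ... | false = refl

    cherry₀₁ cherry₀₂ cherry₁₂ : Family N → Bool
    cherry₀₁ F = trace F (true ∷ true ∷ false ∷ [])
    cherry₀₂ F = trace F (true ∷ false ∷ true ∷ [])
    cherry₁₂ F = trace F (false ∷ true ∷ true ∷ [])

    traceTable : Bool → Bool → Bool → Pattern → Bool
    traceTable x y z (false ∷ false ∷ false ∷ []) = false
    traceTable x y z (true  ∷ false ∷ false ∷ []) = true
    traceTable x y z (false ∷ true  ∷ false ∷ []) = true
    traceTable x y z (false ∷ false ∷ true  ∷ []) = true
    traceTable x y z (true  ∷ true  ∷ true  ∷ []) = true
    traceTable x y z (true  ∷ true  ∷ false ∷ []) = x
    traceTable x y z (true  ∷ false ∷ true  ∷ []) = y
    traceTable x y z (false ∷ true  ∷ true  ∷ []) = z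

    data Shape : Bool → Bool → Bool → Set where
      unresolved : Shape false false false
      resolved₀₁ : Shape true false false
      resolved₀₂ : Shape false true false
      resolved₁₂ : Shape false false true

    shape : ∀ x y z → x ∧ y ≡ false → x ∧ z ≡ false → y ∧ z ≡ false → Shape x y z
    shape false false false _ _ _ = unresolved
    shape true  false false _ _ _ = resolved₀₁
    shape false true  false _ _ _ = resolved₀₂
    shape false false true  _ _ _ = resolved₁₂

    resolvedIn-traceTable : ∀ {x y z} → Shape x y z → resolvedIn (filterᵇ (traceTable x y z) patterns) ≡ x ∨ (y ∨ z)
    resolvedIn-traceTable unresolved = refl
    resolvedIn-traceTable resolved₀₁ = refl
    resolvedIn-traceTable resolved₀₂ = refl
    resolvedIn-traceTable resolved₁₂ = refl

    sameTable : (x y z x′ y′ z′ : Bool) → Bool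
    sameTable x y z x′ y′ z′ = all (λ w → eqᵇ (traceTable x y z w ∷ []) (traceTable x′ y′ z′ w ∷ [])) patterns

    shape-differ-𝟙 : ∀ {x y z x′ y′ z′} → Shape x y z → Shape x′ y′ z′ →
      𝟙 ((x ∨ (y ∨ z)) ∧ (x′ ∨ (y′ ∨ z′)) ∧ not (sameTable x y z x′ y′ z′))
        ≡ 𝟙 x * (𝟙 y′ + 𝟙 z′) + 𝟙 y * (𝟙 x′ + 𝟙 z′) + 𝟙 z * (𝟙 x′ + 𝟙 y′)
    shape-differ-𝟙 unresolved unresolved = refl
    shape-differ-𝟙 unresolved resolved₀₁ = refl
    shape-differ-𝟙 unresolved resolved₀₂ = refl
    shape-differ-𝟙 unresolved resolved₁₂ = refl
    shape-differ-𝟙 resolved₀₁ unresolved = refl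
    shape-differ-𝟙 resolved₀₁ resolved₀₁ = refl
    shape-differ-𝟙 resolved₀₁ resolved₀₂ = refl
    shape-differ-𝟙 resolved₀₁ resolved₁₂ = refl
    shape-differ-𝟙 resolved₀₂ unresolved = refl
    shape-differ-𝟙 resolved₀₂ resolved₀₁ = refl
    shape-differ-𝟙 resolved₀₂ resolved₀₂ = refl
    shape-differ-𝟙 resolved₀₂ resolved₁₂ = refl
    shape-differ-𝟙 resolved₁₂ unresolved = refl
    shape-differ-𝟙 resolved₁₂ resolved₀₁ = refl
    shape-differ-𝟙 resolved₁₂ resolved₀₂ = refl
    shape-differ-𝟙 resolved₁₂ resolved₁₂ = refl

    shape-resolved-𝟙 : ∀ {x y z} → Shape x y z → 𝟙 (x ∨ (y ∨ z)) ≡ 𝟙 x + 𝟙 y + 𝟙 z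
    shape-resolved-𝟙 unresolved = refl
    shape-resolved-𝟙 resolved₀₁ = refl
    shape-resolved-𝟙 resolved₀₂ = refl
    shape-resolved-𝟙 resolved₁₂ = refl

    module AtPhylogeny (F : Family N) (F-phy : isPhylogeny F ≡ true) where

      private
        cs : List (Subset N)
        cs = clusters F
        nonempty-ok full-ok singletons-ok compatible-ok : Bool
        nonempty-ok   = all (λ C → not (emptyᵇ C)) cs
        full-ok       = memᵇ (replicate N true) cs
        singletons-ok = allFinᵇ N (λ i → memᵇ (singleton i) cs)
        compatible-ok = all (λ A → all (compatibleᵇ A) cs) cs
        rest : full-ok ∧ (singletons-ok ∧ compatible-ok) ≡ true
        rest = ∧-conicalʳ nonempty-ok _ F-phy

      full∈ : replicate N true ∈ cs
      full∈ = memᵇ⇒∈ (∧-conicalˡ full-ok _ rest)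

      singleton∈ : ∀ i → singleton i ∈ cs
      singleton∈ = memᵇ⇒∈ ∘ allFinᵇ⁻ _ (∧-conicalˡ singletons-ok compatible-ok (∧-conicalʳ full-ok _ rest))

      compatible : ∀ {C D} → C ∈ cs → D ∈ cs → compatibleᵇ C D ≡ true
      compatible {C} C∈ D∈ =
        all-true⁻ (compatibleᵇ C) (all-true⁻ (λ A → all (compatibleᵇ A) cs)
          (∧-conicalʳ singletons-ok compatible-ok (∧-conicalʳ full-ok _ rest)) C∈) D∈

      trace-witness : ∀ {C} → C ∈ cs → (w : Pattern) → C ∩ X₀ ≡ embed w → any (λ C → eqᵇ (C ∩ X₀) (embed w)) cs ≡ true
      trace-witness C∈ w e = any-true⁺ _ C∈ (subst (λ D → eqᵇ D (embed w) ≡ true) (sym e) (eqᵇ-refl (embed w)))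

      cluster-of-trace : (w : Pattern) → trace F w ≡ true → ∃ λ r → (w ++ r) ∈ cs
      cluster-of-trace w e with (c₀ ∷ c₁ ∷ c₂ ∷ r) , C∈ , C≈ ← any-true⁻ _ cs (∧-conicalʳ _ _ e) =
        r , subst (λ c → (c ++ r) ∈ cs) c≡w C∈
        where
        c≡w : c₀ ∷ c₁ ∷ c₂ ∷ [] ≡ w
        c≡w = trans (sym (∩-identityʳ _)) (++-injectiveˡ _ w (eqᵇ⇒≡ _ _ C≈))

      trace-exclusive : (w v : Pattern) → (∀ r s → compatibleᵇ (w ++ r) (v ++ s) ≡ false) →
        trace F w ∧ trace F v ≡ false
      trace-exclusive w v incompatible with trace F w in w-trace | trace F v in v-trace
      ... | false | _     = refl
      ... | true  | false = refl
      ... | true  | true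
        with r , r∈ ← cluster-of-trace w w-trace | s , s∈ ← cluster-of-trace v v-trace
        with () ← trans (sym (compatible r∈ s∈)) (incompatible r s)

      trace-table : ∀ w → trace F w ≡ traceTable (cherry₀₁ F) (cherry₀₂ F) (cherry₁₂ F) w
      trace-table (false ∷ false ∷ false ∷ []) =
        cong (λ k → not (k ≡ᵇ 0) ∧ any (λ C → eqᵇ (C ∩ X₀) (embed (false ∷ false ∷ false ∷ []))) cs)
             (∣embed∣ (false ∷ false ∷ false ∷ []))
      trace-table (true  ∷ false ∷ false ∷ []) =
        trace-witness (singleton∈ zero) _ (cong (λ r → true ∷ false ∷ false ∷ r) (∩-zeroʳ _))
      trace-table (false ∷ true  ∷ false ∷ []) =
        trace-witness (singleton∈ (suc zero)) _ (cong (λ r → false ∷ true ∷ false ∷ r) (∩-zeroʳ _))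
      trace-table (false ∷ false ∷ true  ∷ []) =
        trace-witness (singleton∈ (suc (suc zero))) _ (cong (λ r → false ∷ false ∷ true ∷ r) (∩-zeroʳ _))
      trace-table (true  ∷ true  ∷ true  ∷ []) =
        trace-witness full∈ _ (cong (λ r → true ∷ true ∷ true ∷ r) (∩-zeroʳ _))
      trace-table (true  ∷ true  ∷ false ∷ []) = refl
      trace-table (true  ∷ false ∷ true  ∷ []) = refl
      trace-table (false ∷ true  ∷ true  ∷ []) = refl

      -- Clusters meeting X₀ in two different pairs overlap in one point and are nested neither way,
      -- whatever they contain outside X₀, so they are incompatible.
      shape-of : Shape (cherry₀₁ F) (cherry₀₂ F) (cherry₁₂ F)
      shape-of = shape _ _ _
        (trace-exclusive (true ∷ true ∷ false ∷ []) (true ∷ false ∷ true ∷ []) λ _ _ → refl)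
        (trace-exclusive (true ∷ true ∷ false ∷ []) (false ∷ true ∷ true ∷ []) λ _ _ → refl)
        (trace-exclusive (true ∷ false ∷ true ∷ []) (false ∷ true ∷ true ∷ []) λ _ _ → refl)

      resolvedᵇ-cherries : resolvedᵇ F X₀ ≡ cherry₀₁ F ∨ (cherry₀₂ F ∨ cherry₁₂ F)
      resolvedᵇ-cherries = trans (resolvedᵇ-X₀ F)
        (trans (cong resolvedIn (filterᵇ-cong trace-table patterns)) (resolvedIn-traceTable shape-of))

    module _ {F G : Family N} (F-phy : isPhylogeny F ≡ true) (G-phy : isPhylogeny G ≡ true) where
      private
        module F = AtPhylogeny F F-phy
        module G = AtPhylogeny G G-phy

      differentlyResolved-𝟙 : 𝟙 (differentlyResolved F G X₀)
        ≡ 𝟙 (cherry₀₁ F) * (𝟙 (cherry₀₂ G) + 𝟙 (cherry₁₂ G))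
        + 𝟙 (cherry₀₂ F) * (𝟙 (cherry₀₁ G) + 𝟙 (cherry₁₂ G))
        + 𝟙 (cherry₁₂ F) * (𝟙 (cherry₀₁ G) + 𝟙 (cherry₀₂ G))
      differentlyResolved-𝟙
        rewrite F.resolvedᵇ-cherries | G.resolvedᵇ-cherries
              | sameRestrᵇ-X₀ F G
              | all-cong (λ w → cong₂ (λ a b → eqᵇ (a ∷ []) (b ∷ [])) (F.trace-table w) (G.trace-table w)) patterns
              = shape-differ-𝟙 F.shape-of G.shape-of

    resolved-𝟙-cherries : {F : Family N} → isPhylogeny F ≡ true →
      𝟙 (resolvedᵇ F X₀) ≡ 𝟙 (cherry₀₁ F) + 𝟙 (cherry₀₂ F) + 𝟙 (cherry₁₂ F)
    resolved-𝟙-cherries {F} F-phy = trans (cong 𝟙 resolvedᵇ-cherries) (shape-resolved-𝟙 shape-of)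
      where open AtPhylogeny F F-phy

    swap₁₂ swap₀₂ : Permutation′ N
    swap₁₂ = transpose (suc zero) (suc (suc zero))
    swap₀₂ = transpose zero (suc (suc zero))

    act-swap₁₂ : ∀ a b c (r : Vec Bool m) → act swap₁₂ (a ∷ b ∷ c ∷ r) ≡ a ∷ c ∷ b ∷ r
    act-swap₁₂ a b c r = lookup-ext λ i → trans (lookup-act swap₁₂ (a ∷ b ∷ c ∷ r) i) (permuted i)
      where
      permuted : ∀ i → lookup (a ∷ b ∷ c ∷ r) (swap₁₂ ⟨$⟩ˡ i) ≡ lookup (a ∷ c ∷ b ∷ r) i
      permuted zero                = refl
      permuted (suc zero)          = refl
      permuted (suc (suc zero))    = refl
      permuted (suc (suc (suc i))) = refl

    act-swap₀₂ : ∀ a b c (r : Vec Bool m) → act swap₀₂ (a ∷ b ∷ c ∷ r) ≡ c ∷ b ∷ a ∷ r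
    act-swap₀₂ a b c r = lookup-ext λ i → trans (lookup-act swap₀₂ (a ∷ b ∷ c ∷ r) i) (permuted i)
      where
      permuted : ∀ i → lookup (a ∷ b ∷ c ∷ r) (swap₀₂ ⟨$⟩ˡ i) ≡ lookup (c ∷ b ∷ a ∷ r) i
      permuted zero                = refl
      permuted (suc zero)          = refl
      permuted (suc (suc zero))    = refl
      permuted (suc (suc (suc i))) = refl

    count-trace-act : (σ : Permutation′ N) (w v : Pattern) → act σ X₀ ≡ X₀ → act σ (embed w) ≡ embed v →
      ∑RP (λ F → 𝟙 (trace F v)) ≡ ∑RP (λ F → 𝟙 (trace F w))
    count-trace-act σ w v σX₀ σw = trans (sum-RP-actF σ _) (sum-cong-∈ (RP N) λ {F} _ → cong 𝟙 (begin
      inRestrᵇ (actF σ F) X₀ (embed v)                 ≡⟨ cong₂ (inRestrᵇ (actF σ F)) (sym σX₀) (sym σw) ⟩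
      inRestrᵇ (actF σ F) (act σ X₀) (act σ (embed w)) ≡⟨ Invariance.inRestrᵇ-act σ F X₀ (embed w) ⟩
      inRestrᵇ F X₀ (embed w)                          ∎))
      where open ≡-Reasoning

    cherries : ℕ
    cherries = ∑RP (𝟙 ∘ cherry₀₁)

    count-cherry₀₂ : ∑RP (𝟙 ∘ cherry₀₂) ≡ cherries
    count-cherry₀₂ = count-trace-act swap₁₂ (true ∷ true ∷ false ∷ []) (true ∷ false ∷ true ∷ [])
      (act-swap₁₂ true true true ⊥) (act-swap₁₂ true true false ⊥)

    count-cherry₁₂ : ∑RP (𝟙 ∘ cherry₁₂) ≡ cherries
    count-cherry₁₂ = count-trace-act swap₀₂ (true ∷ true ∷ false ∷ []) (false ∷ true ∷ true ∷ [])
      (act-swap₀₂ true true true ⊥) (act-swap₀₂ true true false ⊥)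

  differentlyResolved-invariant : Invariant (differentlyResolved {n})
  differentlyResolved-invariant π F G X = cong₂ _∧_ (resolvedᵇ-act F X)
    (cong₂ (λ b c → b ∧ not c) (resolvedᵇ-act G X) (sameRestrᵇ-act F G X))
    where open Invariance π

  resolvedOnlyInFirst-invariant : Invariant (resolvedOnlyInFirst {n})
  resolvedOnlyInFirst-invariant π F G X = cong₂ (λ b c → b ∧ not c) (resolvedᵇ-act F X) (resolvedᵇ-act G X)
    where open Invariance π

  resolvedOnlyInSecond-invariant : Invariant (resolvedOnlyInSecond {n})
  resolvedOnlyInSecond-invariant π F G X = cong₂ (λ b c → not b ∧ c) (resolvedᵇ-act F X) (resolvedᵇ-act G X)
    where open Invariance π

  module Counts (m : ℕ) where

    open FirstTriplet m

    triplet-orbit : ∀ {X} → X ∈ triplets N → ∃ λ π → act π X₀ ≡ X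
    triplet-orbit {X} X∈ = equal-size⇒act X₀ X (trans ∣X₀∣ (sym (≡ᵇ⇒≡ ∣ X ∣ 3 size-3)))
      where
      ∣X₀∣ : ∣ X₀ ∣ ≡ 3
      ∣X₀∣ = ∣embed∣ (true ∷ true ∷ true ∷ [])
      size-3 : T (∣ X ∣ ≡ᵇ 3)
      size-3 = Equivalence.from T-≡ (proj₂ (∈-filterᵇ⁻ (λ Y → ∣ Y ∣ ≡ᵇ 3) {subsets N} X∈))

    sum-pairs-triplets : {φ : TripletPredicate N} → Invariant φ →
      (∑RP λ F → ∑RP λ G → length (filterᵇ (φ F G) (triplets N))) ≡ (N choose 3) * pairCount φ X₀
    sum-pairs-triplets {φ} inv = trans (sum-pairs-count-orbit {φ = φ} inv (triplets N) X₀ triplet-orbit)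
      (cong (λ k → k * pairCount φ X₀) (number-of-subsets-of-size N 3))

    resolvedCount unresolvedCount : ℕ
    resolvedCount   = ∑RP λ F → 𝟙 (resolvedᵇ F X₀)
    unresolvedCount = ∑RP λ F → 𝟙 (not (resolvedᵇ F X₀))

    ∣RP∣≡resolved+unresolved : length (RP N) ≡ resolvedCount + unresolvedCount
    ∣RP∣≡resolved+unresolved = begin
      length (RP N)
        ≡⟨ *-identityʳ _ ⟨
      length (RP N) * 1
        ≡⟨ sum-const _ 1 (RP N) (λ {F} _ → 𝟙-+-𝟙-not (resolvedᵇ F X₀)) ⟨
      (∑RP λ F → 𝟙 (resolvedᵇ F X₀) + 𝟙 (not (resolvedᵇ F X₀)))
        ≡⟨ sum-map-+ _ _ (RP N) ⟩
      resolvedCount + unresolvedCount ∎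
      where open ≡-Reasoning

    resolvedCount≡3cherries : resolvedCount ≡ cherries + cherries + cherries
    resolvedCount≡3cherries = begin
      resolvedCount
        ≡⟨ sum-cong-∈ (RP N) (resolved-𝟙-cherries ∘ ∈-RP⁻) ⟩
      (∑RP λ F → 𝟙 (cherry₀₁ F) + 𝟙 (cherry₀₂ F) + 𝟙 (cherry₁₂ F))
        ≡⟨ sum-map-+ _ _ (RP N) ⟩
      (∑RP λ F → 𝟙 (cherry₀₁ F) + 𝟙 (cherry₀₂ F)) + ∑RP (𝟙 ∘ cherry₁₂)
        ≡⟨ cong (_+ ∑RP (𝟙 ∘ cherry₁₂)) (sum-map-+ _ _ (RP N)) ⟩
      cherries + ∑RP (𝟙 ∘ cherry₀₂) + ∑RP (𝟙 ∘ cherry₁₂)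
        ≡⟨ cong₂ (λ a b → cherries + a + b) count-cherry₀₂ count-cherry₁₂ ⟩
      cherries + cherries + cherries ∎
      where open ≡-Reasoning

    pairCount-resolvedOnlyInFirst : pairCount resolvedOnlyInFirst X₀ ≡ resolvedCount * unresolvedCount
    pairCount-resolvedOnlyInFirst = trans
      (sum-cong-∈ (RP N) λ {F} _ → sum-cong-∈ (RP N) λ {G} _ → 𝟙-∧ (resolvedᵇ F X₀) (not (resolvedᵇ G X₀)))
      (sum-sum-* _ _ (RP N) (RP N))

    pairCount-resolvedOnlyInSecond : pairCount resolvedOnlyInSecond X₀ ≡ unresolvedCount * resolvedCount
    pairCount-resolvedOnlyInSecond = trans
      (sum-cong-∈ (RP N) λ {F} _ → sum-cong-∈ (RP N) λ {G} _ → 𝟙-∧ (not (resolvedᵇ F X₀)) (resolvedᵇ G X₀))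
      (sum-sum-* _ _ (RP N) (RP N))

    pairCount-differentlyResolved : pairCount differentlyResolved X₀
      ≡ cherries * (cherries + cherries) + cherries * (cherries + cherries) + cherries * (cherries + cherries)
    pairCount-differentlyResolved = begin
      pairCount differentlyResolved X₀
        ≡⟨ sum-cong-∈ (RP N) (λ F∈ → sum-cong-∈ (RP N) λ G∈ → differentlyResolved-𝟙 (∈-RP⁻ F∈) (∈-RP⁻ G∈)) ⟩
      (∑RP λ F → ∑RP λ G → t₀₁ F G + t₀₂ F G + t₁₂ F G)
        ≡⟨ sum-sum-+ _ _ (RP N) (RP N) ⟩
      (∑RP λ F → ∑RP λ G → t₀₁ F G + t₀₂ F G) + (∑RP λ F → ∑RP λ G → t₁₂ F G)
        ≡⟨ cong (_+ (∑RP λ F → ∑RP λ G → t₁₂ F G)) (sum-sum-+ _ _ (RP N) (RP N)) ⟩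
      (∑RP λ F → ∑RP λ G → t₀₁ F G) + (∑RP λ F → ∑RP λ G → t₀₂ F G) + (∑RP λ F → ∑RP λ G → t₁₂ F G)
        ≡⟨ cong₂ _+_ (cong₂ _+_ (bilinear cherry₀₁ cherry₀₂ cherry₁₂ refl count-cherry₀₂ count-cherry₁₂)
                                (bilinear cherry₀₂ cherry₀₁ cherry₁₂ count-cherry₀₂ refl count-cherry₁₂))
                     (bilinear cherry₁₂ cherry₀₁ cherry₀₂ count-cherry₁₂ refl count-cherry₀₂) ⟩
      cherries * (cherries + cherries) + cherries * (cherries + cherries) + cherries * (cherries + cherries) ∎
      where
      open ≡-Reasoning
      t₀₁ t₀₂ t₁₂ : Family N → Family N → ℕ
      t₀₁ F G = 𝟙 (cherry₀₁ F) * (𝟙 (cherry₀₂ G) + 𝟙 (cherry₁₂ G))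
      t₀₂ F G = 𝟙 (cherry₀₂ F) * (𝟙 (cherry₀₁ G) + 𝟙 (cherry₁₂ G))
      t₁₂ F G = 𝟙 (cherry₁₂ F) * (𝟙 (cherry₀₁ G) + 𝟙 (cherry₀₂ G))
      bilinear : (a b c : Family N → Bool) →
        ∑RP (𝟙 ∘ a) ≡ cherries → ∑RP (𝟙 ∘ b) ≡ cherries → ∑RP (𝟙 ∘ c) ≡ cherries →
        (∑RP λ F → ∑RP λ G → 𝟙 (a F) * (𝟙 (b G) + 𝟙 (c G))) ≡ cherries * (cherries + cherries)
      bilinear a b c ∑a ∑b ∑c = trans (sum-sum-* (𝟙 ∘ a) (λ G → 𝟙 (b G) + 𝟙 (c G)) (RP N) (RP N))
        (cong₂ _*_ ∑a (trans (sum-map-+ (𝟙 ∘ b) (𝟙 ∘ c) (RP N)) (cong₂ _+_ ∑b ∑c)))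

open Counting

open import Data.Integer using (+_)
import Data.Integer as ℤ
open import Data.List using (_++_)
import Data.Integer.Properties as ℤ
import Data.Nat as ℕ
import Data.Nat.Properties as ℕ
open import Data.Nat using (_≥_; s≤s)
open import Data.Nat.Combinatorics using (_C_)
open import Data.Rational using (ℚ; _/_; _+_; _*_; _-_; _≤_; 0ℚ; 1ℚ; toℚᵘ)
open import Data.Rational.Properties using (toℚᵘ-injective; toℚᵘ-fromℚᵘ; toℚᵘ-homo-+; toℚᵘ-homo-*)
open import Data.Rational.Solver using (module +-*-Solver)
open import Data.Rational.Unnormalised as ℚᵘ using (mkℚᵘ; *≡*)
import Data.Rational.Unnormalised.Properties as ℚᵘ

open +-*-Solver

toℚᵘ-ℕtoℚ : (k : ℕ) → toℚᵘ (ℕtoℚ k) ℚᵘ.≃ mkℚᵘ (ℤ.+ k) 0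
toℚᵘ-ℕtoℚ k = toℚᵘ-fromℚᵘ (mkℚᵘ (ℤ.+ k) 0)

ℕtoℚ-+ : (a b : ℕ) → ℕtoℚ (a ℕ.+ b) ≡ ℕtoℚ a + ℕtoℚ b
ℕtoℚ-+ a b = toℚᵘ-injective (ℚᵘ.≃-trans (toℚᵘ-ℕtoℚ (a ℕ.+ b)) (ℚᵘ.≃-trans numerators
  (ℚᵘ.≃-sym (ℚᵘ.≃-trans (toℚᵘ-homo-+ (ℕtoℚ a) (ℕtoℚ b)) (ℚᵘ.+-cong (toℚᵘ-ℕtoℚ a) (toℚᵘ-ℕtoℚ b))))))
  where
  numerators : mkℚᵘ (ℤ.+ (a ℕ.+ b)) 0 ℚᵘ.≃ mkℚᵘ (ℤ.+ a) 0 ℚᵘ.+ mkℚᵘ (ℤ.+ b) 0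
  numerators = *≡* (cong (ℤ._* ℤ.+ 1) (trans (ℤ.pos-+ a b)
    (cong₂ ℤ._+_ (sym (ℤ.*-identityʳ (ℤ.+ a))) (sym (ℤ.*-identityʳ (ℤ.+ b))))))

ℕtoℚ-* : (a b : ℕ) → ℕtoℚ (a ℕ.* b) ≡ ℕtoℚ a * ℕtoℚ b
ℕtoℚ-* a b = toℚᵘ-injective (ℚᵘ.≃-trans (toℚᵘ-ℕtoℚ (a ℕ.* b)) (ℚᵘ.≃-trans numerators
  (ℚᵘ.≃-sym (ℚᵘ.≃-trans (toℚᵘ-homo-* (ℕtoℚ a) (ℕtoℚ b)) (ℚᵘ.*-cong (toℚᵘ-ℕtoℚ a) (toℚᵘ-ℕtoℚ b))))))
  where
  numerators : mkℚᵘ (ℤ.+ (a ℕ.* b)) 0 ℚᵘ.≃ mkℚᵘ (ℤ.+ a) 0 ℚᵘ.* mkℚᵘ (ℤ.+ b) 0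
  numerators = *≡* (cong (ℤ._* ℤ.+ 1) (ℤ.pos-* a b))

frac-*-denominator : (a b : ℕ) → frac a (suc b) * ℕtoℚ (suc b) ≡ ℕtoℚ a
frac-*-denominator a b = toℚᵘ-injective (ℚᵘ.≃-trans (toℚᵘ-homo-* (frac a (suc b)) (ℕtoℚ (suc b)))
  (ℚᵘ.≃-trans (ℚᵘ.*-cong (toℚᵘ-fromℚᵘ (mkℚᵘ (ℤ.+ a) b)) (toℚᵘ-ℕtoℚ (suc b)))
    (ℚᵘ.≃-trans cancel (ℚᵘ.≃-sym (toℚᵘ-ℕtoℚ a)))))
  where
  cancel : mkℚᵘ (ℤ.+ a) b ℚᵘ.* mkℚᵘ (ℤ.+ suc b) 0 ℚᵘ.≃ mkℚᵘ (ℤ.+ a) 0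
  cancel = *≡* (trans (ℤ.*-identityʳ (ℤ.+ a ℤ.* ℤ.+ suc b))
    (cong (λ d → ℤ.+ a ℤ.* ℤ.+ d) (sym (ℕ.*-identityʳ (suc b)))))

quotient-unique : {x y n i : ℚ} → x * n ≡ y → i * n ≡ 1ℚ → x ≡ y * i
quotient-unique {x} {y} {n} {i} xn≡y in≡1 = begin
  x             ≡⟨ solve 1 (λ x → x := x :* con 1ℚ) refl x ⟩
  x * 1ℚ        ≡⟨ cong (x *_) (sym in≡1) ⟩
  x * (i * n)   ≡⟨ solve 3 (λ x i n → x :* (i :* n) := (x :* n) :* i) refl x i n ⟩
  (x * n) * i   ≡⟨ cong (_* i) xn≡y ⟩
  y * i         ∎
  where open ≡-Reasoning

affine : ℚ → ℕ → ℕ → ℚ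
affine p a b = ℕtoℚ a + p * ℕtoℚ b

affine-+ : (p : ℚ) (a b a′ b′ : ℕ) → affine p a b + affine p a′ b′ ≡ affine p (a ℕ.+ a′) (b ℕ.+ b′)
affine-+ p a b a′ b′ = begin
  affine p a b + affine p a′ b′
    ≡⟨ solve 5 (λ x y x′ y′ p → (x :+ p :* y) :+ (x′ :+ p :* y′) := (x :+ x′) :+ p :* (y :+ y′))
         refl (ℕtoℚ a) (ℕtoℚ b) (ℕtoℚ a′) (ℕtoℚ b′) p ⟩
  (ℕtoℚ a + ℕtoℚ a′) + p * (ℕtoℚ b + ℕtoℚ b′)
    ≡⟨ cong₂ (λ x y → x + p * y) (ℕtoℚ-+ a a′) (ℕtoℚ-+ b b′) ⟨
  affine p (a ℕ.+ a′) (b ℕ.+ b′) ∎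
  where open ≡-Reasoning

affine-0 : (p : ℚ) → 0ℚ ≡ affine p 0 0
affine-0 = solve 1 (λ p → con 0ℚ := con 0ℚ :+ p :* con 0ℚ) refl

sumℚ-++ : (xs ys : List ℚ) → sumℚ (xs ++ ys) ≡ sumℚ xs + sumℚ ys
sumℚ-++ []       ys = solve 1 (λ y → y := con 0ℚ :+ y) refl (sumℚ ys)
sumℚ-++ (x ∷ xs) ys = trans (cong (λ s → x + s) (sumℚ-++ xs ys))
  (solve 3 (λ x s t → x :+ (s :+ t) := (x :+ s) :+ t) refl x (sumℚ xs) (sumℚ ys))

module _ {A : Set} (p : ℚ) where

  sumℚ-affine : (a b : A → ℕ) → ∀ xs →
    sumℚ (map (λ x → affine p (a x) (b x)) xs) ≡ affine p (sum (map a xs)) (sum (map b xs))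
  sumℚ-affine a b []       = affine-0 p
  sumℚ-affine a b (x ∷ xs) = trans (cong (λ s → affine p (a x) (b x) + s) (sumℚ-affine a b xs))
    (affine-+ p (a x) (b x) (sum (map a xs)) (sum (map b xs)))

  sumℚ-concatMap-affine : (a b : A → A → ℕ) → ∀ xs ys →
    sumℚ (concatMap (λ x → map (λ y → affine p (a x y) (b x y)) ys) xs)
      ≡ affine p (sum (map (λ x → sum (map (a x) ys)) xs)) (sum (map (λ x → sum (map (b x) ys)) xs))
  sumℚ-concatMap-affine a b []       ys = affine-0 p
  sumℚ-concatMap-affine a b (x ∷ xs) ys = begin
    sumℚ (row x ++ concatMap row xs)
      ≡⟨ sumℚ-++ (row x) (concatMap row xs) ⟩
    sumℚ (row x) + sumℚ (concatMap row xs)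
      ≡⟨ cong₂ _+_ (sumℚ-affine (a x) (b x) ys) (sumℚ-concatMap-affine a b xs ys) ⟩
    affine p (rowSum (a x)) (rowSum (b x)) + affine p (gridSum a) (gridSum b)
      ≡⟨ affine-+ p (rowSum (a x)) (rowSum (b x)) (gridSum a) (gridSum b) ⟩
    affine p (rowSum (a x) ℕ.+ gridSum a) (rowSum (b x) ℕ.+ gridSum b) ∎
    where
    open ≡-Reasoning
    row : A → List ℚ
    row x = map (λ y → affine p (a x y) (b x y)) ys
    rowSum : (A → ℕ) → ℕ
    rowSum f = sum (map f ys)
    gridSum : (A → A → ℕ) → ℕ
    gridSum f = sum (map (λ x → sum (map (f x) ys)) xs)

ℕtoℚ-thrice : (x : ℕ) → ℕtoℚ (x ℕ.+ x ℕ.+ x) ≡ ℕtoℚ x + ℕtoℚ x + ℕtoℚ x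
ℕtoℚ-thrice x = trans (ℕtoℚ-+ (x ℕ.+ x) x) (cong (_+ ℕtoℚ x) (ℕtoℚ-+ x x))

expectation-algebra : (N R U A K D : ℕ) (p : ℚ) →
  N ≡ R ℕ.+ U → R ≡ A ℕ.+ A ℕ.+ A → D ≡ A ℕ.* (A ℕ.+ A) ℕ.+ A ℕ.* (A ℕ.+ A) ℕ.+ A ℕ.* (A ℕ.+ A) →
  frac 1 (N ℕ.* N) * affine p (K ℕ.* D) (K ℕ.* (R ℕ.* U) ℕ.+ K ℕ.* (U ℕ.* R))
    ≡ ℕtoℚ K * ((+ 2 / 3) * (frac R N * frac R N) + (+ 2 / 1) * p * frac R N * (1ℚ - frac R N))
-- frac _ 0 is 0ℚ, so for N = 0 (which does not occur) both sides vanish.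
expectation-algebra zero R U A K D p _ _ _ =
  solve 3 (λ x k p → con 0ℚ :* x
                 := k :* (con (+ 2 / 3) :* (con 0ℚ :* con 0ℚ) :+ con (+ 2 / 1) :* p :* con 0ℚ :* (con 1ℚ :- con 0ℚ)))
    refl (affine p (K ℕ.* D) (K ℕ.* (R ℕ.* U) ℕ.+ K ℕ.* (U ℕ.* R))) (ℕtoℚ K) p
expectation-algebra (suc M) R U A K D p N≡R+U refl refl = begin
  frac 1 (N ℕ.* N) * (ℕtoℚ (K ℕ.* D) + p * ℕtoℚ (K ℕ.* (R ℕ.* U) ℕ.+ K ℕ.* (U ℕ.* R)))
    ≡⟨ cong₂ _*_ j≡i² (cong₂ (λ x y → x + p * y) ℕtoℚ-KD ℕtoℚ-KRU) ⟩
  (1ℚ * (i * i)) * (κ * (a * (a + a) + a * (a + a) + a * (a + a)) + p * (κ * (r * u) + κ * (u * r)))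
    ≡⟨ solve 5 (λ a u κ p i →
         (con 1ℚ :* (i :* i)) :* (κ :* (a :* (a :+ a) :+ a :* (a :+ a) :+ a :* (a :+ a))
           :+ p :* (κ :* ((a :+ a :+ a) :* u) :+ κ :* (u :* (a :+ a :+ a))))
         := κ :* (con (+ 2 / 3) :* (((a :+ a :+ a) :* i) :* ((a :+ a :+ a) :* i))
           :+ con (+ 2 / 1) :* p :* ((a :+ a :+ a) :* i) :* ((((a :+ a :+ a) :+ u) :* i) :- ((a :+ a :+ a) :* i))))
         refl a u κ p i ⟩
  κ * ((+ 2 / 3) * ((r * i) * (r * i)) + (+ 2 / 1) * p * (r * i) * (((r + u) * i) - (r * i)))
    ≡⟨ cong₂ (λ x y → κ * ((+ 2 / 3) * (x * x) + (+ 2 / 1) * p * x * (y - x))) (sym frac-R) (sym 1≡[r+u]i) ⟩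
  κ * ((+ 2 / 3) * (frac R N * frac R N) + (+ 2 / 1) * p * frac R N * (1ℚ - frac R N)) ∎
  where
  open ≡-Reasoning
  N : ℕ
  N = suc M
  a u κ ν r i : ℚ
  a = ℕtoℚ A
  u = ℕtoℚ U
  κ = ℕtoℚ K
  ν = ℕtoℚ N
  r = a + a + a
  i = frac 1 N
  iν≡1 : i * ν ≡ 1ℚ
  iν≡1 = frac-*-denominator 1 M
  j≡i² : frac 1 (N ℕ.* N) ≡ 1ℚ * (i * i)
  j≡i² = quotient-unique {n = ν * ν} {i = i * i}
    (trans (cong (frac 1 (N ℕ.* N) *_) (sym (ℕtoℚ-* N N))) (frac-*-denominator 1 (M ℕ.+ M ℕ.* N)))
    (trans (solve 2 (λ i ν → (i :* i) :* (ν :* ν) := (i :* ν) :* (i :* ν)) refl i ν)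
           (trans (cong₂ _*_ iν≡1 iν≡1) (solve 0 (con 1ℚ :* con 1ℚ := con 1ℚ) refl)))
  ℕtoℚ-R : ℕtoℚ R ≡ r
  ℕtoℚ-R = ℕtoℚ-thrice A
  frac-R : frac R N ≡ r * i
  frac-R = trans (quotient-unique {n = ν} {i = i} (frac-*-denominator R M) iν≡1) (cong (_* i) ℕtoℚ-R)
  1≡[r+u]i : 1ℚ ≡ (r + u) * i
  1≡[r+u]i = trans (sym iν≡1) (trans (solve 2 (λ i ν → i :* ν := ν :* i) refl i ν)
    (cong (_* i) (trans (cong ℕtoℚ N≡R+U) (trans (ℕtoℚ-+ R U) (cong (_+ u) ℕtoℚ-R)))))
  ℕtoℚ-KD : ℕtoℚ (K ℕ.* D) ≡ κ * (a * (a + a) + a * (a + a) + a * (a + a))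
  ℕtoℚ-KD = trans (ℕtoℚ-* K D) (cong (κ *_) (trans (ℕtoℚ-thrice (A ℕ.* (A ℕ.+ A)))
    (cong (λ x → x + x + x) (trans (ℕtoℚ-* A (A ℕ.+ A)) (cong (a *_) (ℕtoℚ-+ A A))))))
  ℕtoℚ-KRU : ℕtoℚ (K ℕ.* (R ℕ.* U) ℕ.+ K ℕ.* (U ℕ.* R)) ≡ κ * (r * u) + κ * (u * r)
  ℕtoℚ-KRU = trans (ℕtoℚ-+ (K ℕ.* (R ℕ.* U)) (K ℕ.* (U ℕ.* R))) (cong₂ _+_
    (trans (ℕtoℚ-* K (R ℕ.* U)) (cong (κ *_) (trans (ℕtoℚ-* R U) (cong (_* u) ℕtoℚ-R))))
    (trans (ℕtoℚ-* K (U ℕ.* R)) (cong (κ *_) (trans (ℕtoℚ-* U R) (cong (u *_) ℕtoℚ-R)))))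

expectedDist-formula : (m : ℕ) (p : ℚ) → let n = 3 ℕ.+ m in
  expectedDist n p ≡ ℕtoℚ (n C 3) * ((+ 2 / 3) * (r′ n * r′ n) + (+ 2 / 1) * p * r′ n * u′ n)
expectedDist-formula m p = begin
  j * sumℚ (concatMap (λ F → map (λ G → dp p F G) (RP N)) (RP N))
    ≡⟨ cong (j *_) (sumℚ-concatMap-affine p Dcount R₁₂ (RP N) (RP N)) ⟩
  j * affine p (∑RP {N} λ F → ∑RP λ G → Dcount F G) (∑RP {N} λ F → ∑RP λ G → R₁₂ F G)
    ≡⟨ cong₂ (λ x y → j * affine p x y) total-D total-R ⟩
  j * affine p (K ℕ.* D) (K ℕ.* (Rc ℕ.* Uc) ℕ.+ K ℕ.* (Uc ℕ.* Rc))
    ≡⟨ expectation-algebra ∣RP∣ Rc Uc cherries K D p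
         ∣RP∣≡resolved+unresolved resolvedCount≡3cherries pairCount-differentlyResolved ⟩
  ℕtoℚ K * ((+ 2 / 3) * (frac Rc ∣RP∣ * frac Rc ∣RP∣) + (+ 2 / 1) * p * frac Rc ∣RP∣ * (1ℚ - frac Rc ∣RP∣))
    ≡⟨ cong (λ R → ℕtoℚ K * ((+ 2 / 3) * (frac R ∣RP∣ * frac R ∣RP∣)
                              + (+ 2 / 1) * p * frac R ∣RP∣ * (1ℚ - frac R ∣RP∣)))
            (sym (length-filterᵇ (λ F → resolvedᵇ F X₀) (RP N))) ⟩
  ℕtoℚ K * ((+ 2 / 3) * (r′ N * r′ N) + (+ 2 / 1) * p * r′ N * u′ N) ∎
  where
  open ≡-Reasoning
  open FirstTriplet m using (N; X₀; cherries)
  open Counts m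
  ∣RP∣ K D Rc Uc : ℕ
  ∣RP∣ = length (RP N)
  K = N C 3
  D = pairCount differentlyResolved X₀
  Rc = resolvedCount
  Uc = unresolvedCount
  j : ℚ
  j = frac 1 (∣RP∣ ℕ.* ∣RP∣)
  R₁₂ : Family N → Family N → ℕ
  R₁₂ F G = R1count F G ℕ.+ R2count F G
  total-D : (∑RP {N} λ F → ∑RP λ G → Dcount F G) ≡ K ℕ.* D
  total-D = sum-pairs-triplets differentlyResolved-invariant
  total-R : (∑RP {N} λ F → ∑RP λ G → R₁₂ F G) ≡ K ℕ.* (Rc ℕ.* Uc) ℕ.+ K ℕ.* (Uc ℕ.* Rc)
  total-R = trans (sum-sum-+ R1count R2count (RP N) (RP N)) (cong₂ ℕ._+_
    (trans (sum-pairs-triplets resolvedOnlyInFirst-invariant) (cong (K ℕ.*_) pairCount-resolvedOnlyInFirst))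
    (trans (sum-pairs-triplets resolvedOnlyInSecond-invariant) (cong (K ℕ.*_) pairCount-resolvedOnlyInSecond)))

lemma1 : (n : ℕ) → n ≥ 3 → (p : ℚ) → 0ℚ ≤ p × p ≤ 1ℚ →
    expectedDist n p
    ≡ ℕtoℚ (n C 3) * ((+ 2 / 3) * (r′ n * r′ n) + (+ 2 / 1) * p * r′ n * u′ n)
lemma1 (suc (suc (suc m))) _ p _ = expectedDist-formula m p
lemma1 (suc zero)       (s≤s ())       _ _
lemma1 (suc (suc zero)) (s≤s (s≤s ())) _ _
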